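{- For every $\xi\in\mathcal Z_1$, all points of $\tilde S_\xi$ are nonsingular, and for every $\xi\in\mathcal Z_2$, all points of $\tilde S_\xi$ are singular.
   Context: Let $q$ be an odd prime power. A point $P=\langle(\alpha,\beta,\gamma,\delta)\rangle$ of $\mathrm{PG}(3,q^2)$ corresponds to $T_P(x,y)=\alpha xy+\beta xy^q+\gamma x^qy+\delta x^qy^q$ on $\mathbb{F}_{q^2}$; $P$ is nonsingular if $T_P(x,y)\neq0$ whenever $x\neq0\neq y$, singular otherwise. Let $Q=\alpha\delta-\beta\gamma$ and $H=\alpha^{q+1}-\beta^{q+1}-\gamma^{q+1}+\delta^{q+1}$; $\mathcal H$ is the Hermitian surface $H=0$. For $\xi\in\mathbb{F}_{q^2}$, $S_\xi$ is the set of points of $\mathrm{PG}(3,q^2)$ satisfying $H-2\xi Q^{(q+1)/2}=0$, and $\tilde S_\xi=S_\xi\setminus\mathcal H$. $\mathcal Z_1=\{\xi\in\mathbb{F}_{q^2}:\xi^{2(q-1)}=1,\ \xi\neq\pm1,\ 1-\xi^{ -2}\text{ a nonzero square in }\mathbb{F}_q\}$ and $\mathcal Z_2=\{\xi\in\mathbb{F}_{q^2}:\xi^{2(q-1)}=1,\ 1-\xi^{ -2}\text{ a nonsquare in }\mathbb{F}_q\}$. -}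

module Defs where

open import Level using (0ℓ)
open import Data.Nat as ℕ using (ℕ; zero; suc)
open import Data.Nat.Primality using (Prime)
open import Data.Nat.DivMod using (_/_)
open import Data.Fin using (Fin)
open import Data.Product using (Σ; ∃; _×_; _,_)
open import Relation.Binary.PropositionalEquality using (_≡_; _≢_)
open import Relation.Nullary using (¬_)
open import Function.Bundles using (_↔_)
open import Algebra.Structures using (IsCommutativeRing)

OddPrimePower : ℕ → Set
OddPrimePower q = Σ ℕ λ p → Σ ℕ λ k →
  Prime p × (p ℕ.% 2 ≡ 1) × (q ≡ p ℕ.^ suc k)

record Field : Set₁ where
  infixl 7 _*_
  infixl 6 _+_ _-_
  field
    Carrier : Set
    _+_ _*_ : Carrier → Carrier → Carrier
    -_      : Carrier → Carrier
    0# 1#   : Carrier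
    _⁻¹     : Carrier → Carrier
    isCommutativeRing : IsCommutativeRing _≡_ _+_ _*_ -_ 0# 1#
    0≢1     : 0# ≢ 1#
    ⁻¹-inverse : ∀ x → x ≢ 0# → x * (x ⁻¹) ≡ 1#

  _-_ : Carrier → Carrier → Carrier
  x - y = x + (- y)

  infixr 8 _^_
  _^_ : Carrier → ℕ → Carrier
  x ^ zero  = 1#
  x ^ suc n = x * (x ^ n)

  2# : Carrier
  2# = 1# + 1#

HasCard : Field → ℕ → Set
HasCard F n = Field.Carrier F ↔ Fin n

module Hermitian (q : ℕ) (F : Field) where
  open Field F

  InFq : Carrier → Set
  InFq x = x ^ q ≡ x

  IsSquareFq : Carrier → Set
  IsSquareFq x = ∃ λ y → InFq y × (y * y ≡ x)

  NonzeroSquareFq : Carrier → Set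
  NonzeroSquareFq x = InFq x × x ≢ 0# × IsSquareFq x

  NonsquareFq : Carrier → Set
  NonsquareFq x = InFq x × x ≢ 0# × ¬ IsSquareFq x

  Z₁ : Carrier → Set
  Z₁ ξ = (ξ ^ (2 ℕ.* (q ℕ.∸ 1)) ≡ 1#) × ξ ≢ 1# × ξ ≢ - 1#
       × NonzeroSquareFq (1# - (ξ ⁻¹) ^ 2)

  Z₂ : Carrier → Set
  Z₂ ξ = (ξ ^ (2 ℕ.* (q ℕ.∸ 1)) ≡ 1#) × NonsquareFq (1# - (ξ ⁻¹) ^ 2)

  -- homogeneous coordinates (α, β, γ, δ) of a point of PG(3, q^2)
  record Coords : Set where
    constructor ⟨_,_,_,_⟩
    field α β γ δ : Carrier

  NonzeroVec : Coords → Set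
  NonzeroVec ⟨ a , b , c , d ⟩ = ¬ (a ≡ 0# × b ≡ 0# × c ≡ 0# × d ≡ 0#)

  T : Coords → Carrier → Carrier → Carrier
  T ⟨ a , b , c , d ⟩ x y =
    a * x * y + b * x * (y ^ q) + c * (x ^ q) * y + d * (x ^ q) * (y ^ q)

  Nonsingular : Coords → Set
  Nonsingular P = ∀ x y → x ≢ 0# → y ≢ 0# → T P x y ≢ 0#

  Singular : Coords → Set
  Singular P = ∃ λ x → ∃ λ y → x ≢ 0# × y ≢ 0# × T P x y ≡ 0#

  Qf : Coords → Carrier
  Qf ⟨ a , b , c , d ⟩ = a * d - b * c

  Hf : Coords → Carrier
  Hf ⟨ a , b , c , d ⟩ =
    a ^ (q ℕ.+ 1) - b ^ (q ℕ.+ 1) - c ^ (q ℕ.+ 1) + d ^ (q ℕ.+ 1)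

  InS : Carrier → Coords → Set
  InS ξ P = Hf P - 2# * ξ * (Qf P ^ ((q ℕ.+ 1) / 2)) ≡ 0#

  -- P ∈ S̃_ξ = S_ξ ∖ 𝓗
  InS̃ : Carrier → Coords → Set
  InS̃ ξ P = InS ξ P × Hf P ≢ 0#

module Submission where

-- Write x̄ = x ^ q for the involution of F = F_{q²} fixing F_q, and N z = z z̄.  For
-- P = (a, b, c, d) one has T_P(x, y) = Aₓ y + Bₓ ȳ, and a semilinear form A y + B ȳ has a
-- nonzero root y exactly when N A = N B (Hilbert 90).  Expanding, N Aₓ - N Bₓ =
-- x x̄ β + x² ω + (x² ω)‾ for explicit β, ω depending on P, whose discriminant β² - 4 ω ω̄
-- equals H² - 4 Q Q̄, that is H² (1 - ξ⁻²) on S_ξ.  Put z = x² ω.  If 1 - ξ⁻² = r² with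
-- r ∈ F_q, a root x would make (z - z̄)² the square of the nonzero self-conjugate x x̄ H r,
-- impossible as z - z̄ is anticonjugate.  If 1 - ξ⁻² is a nonsquare of F_q, its square root
-- in F is anticonjugate, so the roots of Z² + β Z + ω ω̄ are conjugate to each other and
-- Hilbert 90 turns one of them into a nonzero root x.  The facts about F_{q²} used here
-- (characteristic p, x ^ q² = x, every element of F_q is a square in F) follow from |F| = q²
-- by counting: the sum of all elements is invariant under translation, the product of all
-- units is invariant under scaling, and pairing x with D / x computes that product
-- (Euler's criterion and Wilson's theorem).

open import Defs
open import Data.Nat as ℕ using (ℕ; zero; suc)
import Data.Nat.Properties as ℕ
open import Relation.Binary.PropositionalEquality
open import Relation.Binary.Definitions using (DecidableEquality)
open import Algebra.Core using (Op₂)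
open import Algebra.Structures using (IsCommutativeMonoid)

module Binomial where

  open import Data.Nat using (_+_; _*_; _<_)
  open import Data.Nat.Combinatorics using (_C_; nCk+nC[k+1]≡[n+1]C[k+1])
  open import Data.Nat.Divisibility using (_∣_; ∣⇒≤; m∣m*n)
  open import Data.Nat.Primality using (Prime; euclidsLemma)
  open import Data.Nat.Solver using (module +-*-Solver)
  open import Data.Sum using (inj₁; inj₂)
  open import Data.Empty using (⊥-elim)
  open +-*-Solver using (solve; _:=_; _:+_; _:*_; con)

  [1+k]*[1+n]C[1+k]≡[1+n]*nCk : ∀ n k → suc k * (suc n C suc k) ≡ suc n * (n C k)
  [1+k]*[1+n]C[1+k]≡[1+n]*nCk zero    zero    = refl
  [1+k]*[1+n]C[1+k]≡[1+n]*nCk zero    (suc k) = ℕ.*-zeroʳ (suc (suc k))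
  [1+k]*[1+n]C[1+k]≡[1+n]*nCk (suc n) zero    = begin
    1 * (suc (suc n) C 1)    ≡⟨ cong (1 *_) (sym (nCk+nC[k+1]≡[n+1]C[k+1] (suc n) 0)) ⟩
    1 * (1 + suc n C 1)      ≡⟨ cong (λ c → 1 * (1 + c)) (trans (sym (ℕ.*-identityˡ _)) ([1+k]*[1+n]C[1+k]≡[1+n]*nCk n 0)) ⟩
    1 * (1 + suc n * 1)      ≡⟨ solve 1 (λ n → con 1 :* (con 1 :+ (con 1 :+ n) :* con 1) := (con 2 :+ n) :* con 1) refl n ⟩
    suc (suc n) * 1          ∎
    where open ≡-Reasoning
  [1+k]*[1+n]C[1+k]≡[1+n]*nCk (suc n) (suc k) = begin
    suc (suc k) * (suc (suc n) C suc (suc k))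
      ≡⟨ cong (suc (suc k) *_) (sym (nCk+nC[k+1]≡[n+1]C[k+1] (suc n) (suc k))) ⟩
    suc (suc k) * (A + B)
      ≡⟨ solve 3 (λ k A B → (con 2 :+ k) :* (A :+ B) := (con 1 :+ k) :* A :+ A :+ (con 2 :+ k) :* B) refl k A B ⟩
    suc k * A + A + suc (suc k) * B
      ≡⟨ cong₂ (λ u v → u + A + v) ([1+k]*[1+n]C[1+k]≡[1+n]*nCk n k) ([1+k]*[1+n]C[1+k]≡[1+n]*nCk n (suc k)) ⟩
    suc n * a + A + suc n * b
      ≡⟨ solve 4 (λ n a A b → (con 1 :+ n) :* a :+ A :+ (con 1 :+ n) :* b := A :+ (con 1 :+ n) :* (a :+ b)) refl n a A b ⟩
    A + suc n * (a + b)
      ≡⟨ cong (λ c → A + suc n * c) (nCk+nC[k+1]≡[n+1]C[k+1] n k) ⟩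
    A + suc n * A
      ∎
    where
    open ≡-Reasoning
    A = suc n C suc k
    B = suc n C suc (suc k)
    a = n C k
    b = n C suc k

  prime∣pCk : ∀ {p k} → Prime p → 0 < k → k < p → p ∣ p C k
  prime∣pCk {suc n} {suc k} p-prime _ k<p
    with euclidsLemma (suc k) (suc n C suc k) p-prime
           (subst (suc n ∣_) (sym ([1+k]*[1+n]C[1+k]≡[1+n]*nCk n k)) (m∣m*n (n C k)))
  ... | inj₁ p∣1+k = ⊥-elim (ℕ.<⇒≱ k<p (∣⇒≤ p∣1+k))
  ... | inj₂ p∣pCk = p∣pCk

module OddNumbers where

  open import Data.Nat using (_+_; _*_; _^_)
  open import Data.Nat.DivMod using (_/_; _%_; m≡m%n+[m/n]*n; %-distribˡ-*)
  open import Data.Nat.Solver using (module +-*-Solver)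
  open +-*-Solver using (solve; _:=_; _:+_; _:*_; con)

  n%2≡1⇒n≡1+2[n/2] : ∀ n → n % 2 ≡ 1 → n ≡ suc (n / 2 + n / 2)
  n%2≡1⇒n≡1+2[n/2] n n%2≡1 = begin
    n                      ≡⟨ m≡m%n+[m/n]*n n 2 ⟩
    n % 2 + n / 2 * 2      ≡⟨ cong (_+ n / 2 * 2) n%2≡1 ⟩
    1 + n / 2 * 2          ≡⟨ solve 1 (λ m → con 1 :+ m :* con 2 := con 1 :+ (m :+ m)) refl (n / 2) ⟩
    suc (n / 2 + n / 2)    ∎
    where open ≡-Reasoning

  p%2≡1⇒p^n%2≡1 : ∀ {p} → p % 2 ≡ 1 → ∀ n → p ^ n % 2 ≡ 1
  p%2≡1⇒p^n%2≡1     p%2≡1 zero    = refl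
  p%2≡1⇒p^n%2≡1 {p} p%2≡1 (suc n) = begin
    p * p ^ n % 2                ≡⟨ %-distribˡ-* p (p ^ n) 2 ⟩
    (p % 2) * (p ^ n % 2) % 2    ≡⟨ cong₂ (λ a b → a * b % 2) p%2≡1 (p%2≡1⇒p^n%2≡1 p%2≡1 n) ⟩
    1                            ∎
    where open ≡-Reasoning

  [1+2t]²≡1+2[2t[1+t]] : ∀ t → suc (t + t) * suc (t + t) ≡ suc ((t + t) * suc t + (t + t) * suc t)
  [1+2t]²≡1+2[2t[1+t]] = solve 1
    (λ t → (con 1 :+ (t :+ t)) :* (con 1 :+ (t :+ t)) := con 1 :+ ((t :+ t) :* (con 1 :+ t) :+ (t :+ t) :* (con 1 :+ t)))
    refl

module CommutativeFold {A : Set} (_≟_ : DecidableEquality A)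
  {_∙_ : Op₂ A} {ε : A} (isCommutativeMonoid : IsCommutativeMonoid _≡_ _∙_ ε) where

  open import Data.Nat using (_+_; _≤_; s≤s)
  open import Data.List using (List; []; _∷_; foldr; map; length; filter)
  open import Data.List.Membership.Propositional using (_∈_)
  open import Data.List.Membership.Propositional.Properties using (∈-filter⁺; ∈-filter⁻)
  open import Data.List.Membership.Propositional.Properties.WithK using (unique∧set⇒bag)
  open import Data.List.Relation.Binary.BagAndSetEquality using (∼bag⇒↭)
  open import Data.List.Relation.Binary.Permutation.Propositional using (_↭_; ↭⇒↭ₛ)
  open import Data.List.Relation.Binary.Permutation.Propositional.Properties using (↭-length)
  open import Data.List.Relation.Binary.Permutation.Setoid.Properties using (foldr-commMonoid)
  open import Data.List.Relation.Unary.Any using (here; there)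
  open import Data.List.Relation.Unary.All as All using ()
  open import Data.List.Relation.Unary.All.Properties using (All¬⇒¬Any)
  open import Data.List.Relation.Unary.AllPairs using (_∷_)
  open import Data.List.Relation.Unary.Unique.Propositional using (Unique)
  open import Data.List.Relation.Unary.Unique.Propositional.Properties using (filter⁺)
  open import Data.Product using (∃-syntax; _×_; _,_; proj₁; proj₂)
  open import Data.Empty using (⊥-elim)
  open import Function.Bundles using (_⇔_; mk⇔)
  open import Relation.Nullary using (yes; no; ¬?)
  open import Algebra.Bundles using (CommutativeMonoid)
  import Algebra.Definitions.RawMonoid as RawMonoidDefinitions
  import Algebra.Properties.CommutativeSemigroup as CommutativeSemigroupProperties

  commutativeMonoid : CommutativeMonoid _ _
  commutativeMonoid = record { isCommutativeMonoid = isCommutativeMonoid }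

  open CommutativeMonoid commutativeMonoid using (assoc; identityˡ; rawMonoid; commutativeSemigroup)
  open CommutativeSemigroupProperties commutativeSemigroup using (interchange)
  open RawMonoidDefinitions rawMonoid using () renaming (_×_ to _×ᴹ_)

  infixr 8 _^_
  _^_ : A → ℕ → A
  x ^ n = n ×ᴹ x

  fold : List A → A
  fold = foldr _∙_ ε

  fold-↭ : ∀ {xs ys} → xs ↭ ys → fold xs ≡ fold ys
  fold-↭ xs↭ys = foldr-commMonoid (setoid A) isCommutativeMonoid (↭⇒↭ₛ xs↭ys)

  SameElements : List A → List A → Set
  SameElements xs ys = ∀ {z} → z ∈ xs ⇔ z ∈ ys

  unique-sameElements⇒↭ : ∀ {xs ys} → Unique xs → Unique ys → SameElements xs ys → xs ↭ ys
  unique-sameElements⇒↭ xs! ys! xs≈ys = ∼bag⇒↭ (unique∧set⇒bag xs! ys! xs≈ys)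

  fold-map : ∀ c xs → fold (map (c ∙_) xs) ≡ (c ^ length xs) ∙ fold xs
  fold-map c []       = sym (identityˡ ε)
  fold-map c (x ∷ xs) = begin
    (c ∙ x) ∙ fold (map (c ∙_) xs)           ≡⟨ cong ((c ∙ x) ∙_) (fold-map c xs) ⟩
    (c ∙ x) ∙ ((c ^ length xs) ∙ fold xs)    ≡⟨ interchange c x (c ^ length xs) (fold xs) ⟩
    (c ∙ (c ^ length xs)) ∙ (x ∙ fold xs)    ∎
    where open ≡-Reasoning

  _without_ : List A → A → List A
  xs without x = filter (λ y → ¬? (y ≟ x)) xs

  ∈-without⁺ : ∀ {x z xs} → z ∈ xs → z ≢ x → z ∈ xs without x
  ∈-without⁺ {x} = ∈-filter⁺ (λ y → ¬? (y ≟ x))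

  ∈-without⁻ : ∀ {x z xs} → z ∈ xs without x → z ∈ xs × z ≢ x
  ∈-without⁻ {x} = ∈-filter⁻ (λ y → ¬? (y ≟ x))

  without-unique : ∀ {x xs} → Unique xs → Unique (xs without x)
  without-unique {x} = filter⁺ (λ y → ¬? (y ≟ x))

  ↭-∷-without : ∀ {x xs} → Unique xs → x ∈ xs → xs ↭ x ∷ xs without x
  ↭-∷-without {x} {xs} xs! x∈xs =
    unique-sameElements⇒↭ xs! (All.tabulate x≢ ∷ without-unique xs!) (mk⇔ to from)
    where
    x≢ : ∀ {z} → z ∈ xs without x → x ≢ z
    x≢ z∈ x≡z = proj₂ (∈-without⁻ {xs = xs} z∈) (sym x≡z)
    to : ∀ {z} → z ∈ xs → z ∈ x ∷ xs without x
    to {z} z∈xs with z ≟ x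
    ... | yes z≡x = here z≡x
    ... | no  z≢x = there (∈-without⁺ z∈xs z≢x)
    from : ∀ {z} → z ∈ x ∷ xs without x → z ∈ xs
    from (here refl) = x∈xs
    from (there z∈)  = proj₁ (∈-without⁻ z∈)

  record IsPairing (ι : A → A) (c : A) (xs : List A) : Set where
    field
      ι-closed         : ∀ {x} → x ∈ xs → ι x ∈ xs
      ι-fixedPointFree : ∀ {x} → x ∈ xs → ι x ≢ x
      ι-involutive     : ∀ {x} → x ∈ xs → ι (ι x) ≡ x
      ∙-ι              : ∀ {x} → x ∈ xs → x ∙ ι x ≡ c

  private
    pairing-without : ∀ {ι c x rest} → Unique (x ∷ rest) → IsPairing ι c (x ∷ rest) →
                      IsPairing ι c (rest without ι x)
    pairing-without {ι} {c} {x} {rest} (x∉rest ∷ _) pairing = record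
      { ι-closed         = closed
      ; ι-fixedPointFree = λ y∈ → ι-fixedPointFree (inherited y∈)
      ; ι-involutive     = λ y∈ → ι-involutive (inherited y∈)
      ; ∙-ι              = λ y∈ → ∙-ι (inherited y∈)
      }
      where
      open IsPairing pairing
      inherited : ∀ {y} → y ∈ rest without ι x → y ∈ x ∷ rest
      inherited y∈ = there (proj₁ (∈-without⁻ {xs = rest} y∈))
      closed : ∀ {y} → y ∈ rest without ι x → ι y ∈ rest without ι x
      closed {y} y∈ with ∈-without⁻ {xs = rest} y∈ | ι-closed (inherited y∈)
      ... | _      , y≢ιx | here ιy≡x     = ⊥-elim (y≢ιx (trans (sym (ι-involutive (inherited y∈))) (cong ι ιy≡x)))
      ... | y∈rest , _    | there ιy∈rest = ∈-without⁺ ιy∈rest ιy≢ιx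
        where
        y≡x⇒⊥ : y ≢ x
        y≡x⇒⊥ y≡x = All¬⇒¬Any x∉rest (subst (_∈ rest) y≡x y∈rest)
        ιy≢ιx : ι y ≢ ι x
        ιy≢ιx ιy≡ιx = y≡x⇒⊥ (trans (sym (ι-involutive (inherited y∈))) (trans (cong ι ιy≡ιx) (ι-involutive (here refl))))

  fold-pairing : ∀ {ι c xs} → Unique xs → IsPairing ι c xs → ∃[ m ] m + m ≡ length xs × fold xs ≡ c ^ m
  fold-pairing {ι} {c} {xs} = go (length xs) xs ℕ.≤-refl
    where
    go : ∀ n ys → length ys ≤ n → Unique ys → IsPairing ι c ys → ∃[ m ] m + m ≡ length ys × fold ys ≡ c ^ m
    go _       []         _           _                 _       = 0 , refl , refl
    go (suc n) (x ∷ rest) (s≤s len≤n) xs!@(_ ∷ rest!) pairing = suc m , length-eq , fold-eq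
      where
      open IsPairing pairing
      ιx∈rest : ι x ∈ rest
      ιx∈rest with ι-closed (here refl)
      ... | here ιx≡x     = ⊥-elim (ι-fixedPointFree (here refl) ιx≡x)
      ... | there ιx∈rest = ιx∈rest
      rest′ = rest without ι x
      rest↭ : rest ↭ ι x ∷ rest′
      rest↭ = ↭-∷-without rest! ιx∈rest
      length-rest : length rest ≡ suc (length rest′)
      length-rest = ↭-length rest↭
      recursive = go n rest′ (ℕ.≤-trans (ℕ.n≤1+n _) (subst (_≤ n) length-rest len≤n))
                    (without-unique rest!) (pairing-without xs! pairing)
      m = proj₁ recursive
      length-eq : suc (m + suc m) ≡ suc (length rest)
      length-eq = cong suc (trans (ℕ.+-suc m m) (trans (cong suc (proj₁ (proj₂ recursive))) (sym length-rest)))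
      fold-eq : x ∙ fold rest ≡ c ∙ (c ^ m)
      fold-eq = begin
        x ∙ fold rest             ≡⟨ cong (x ∙_) (fold-↭ rest↭) ⟩
        x ∙ (ι x ∙ fold rest′)    ≡⟨ sym (assoc x (ι x) (fold rest′)) ⟩
        (x ∙ ι x) ∙ fold rest′    ≡⟨ cong₂ _∙_ (∙-ι (here refl)) (proj₂ (proj₂ recursive)) ⟩
        c ∙ (c ^ m)               ∎
        where open ≡-Reasoning

module FieldProperties (F : Field) where

  open import Level using (0ℓ)
  open import Data.Integer as ℤ using (ℤ; -[1+_]; _⊖_; _◃_)
  import Data.Integer.Properties as ℤ
  open import Data.Sign as Sign using (Sign)
  open import Data.Maybe using (Maybe; just; nothing)
  open import Relation.Nullary using (yes; no)
  open import Algebra.Bundles using (CommutativeRing)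
  import Algebra.Properties.Ring as RingProperties
  import Algebra.Properties.CommutativeSemigroup as CommutativeSemigroupProperties
  import Algebra.Properties.Semiring.Mult as SemiringMult
  import Algebra.Properties.CommutativeSemiring.Exp as CommutativeSemiringExp
  import Algebra.Solver.Ring
  open import Algebra.Solver.Ring.AlmostCommutativeRing
    using (fromCommutativeRing; _-Raw-AlmostCommutative⟶_)

  open Field F public

  commutativeRing : CommutativeRing 0ℓ 0ℓ
  commutativeRing = record { isCommutativeRing = isCommutativeRing }

  open CommutativeRing commutativeRing public
    using ( +-assoc; +-comm; +-identityˡ; +-identityʳ; -‿inverseˡ; -‿inverseʳ
          ; *-assoc; *-comm; *-identityˡ; *-identityʳ; distribˡ; distribʳ; zeroˡ; zeroʳ
          ; semiring; +-isCommutativeMonoid; *-isCommutativeMonoid)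
  open CommutativeRing commutativeRing
    using (ring; commutativeSemiring; +-commutativeSemigroup; *-commutativeSemigroup)
  open RingProperties ring public
    using ( -0#≈0#; -‿involutive; -‿+-comm; -‿distribʳ-*; -1*x≈-x
          ; +-inverseˡ-unique; +-identityˡ-unique; +-cancelˡ; x+x≈x⇒x≈0)
  open RingProperties ring using (x∙y⁻¹≈ε⇒x≈y; x≈y⇒x∙y⁻¹≈ε)
  open CommutativeSemigroupProperties +-commutativeSemigroup
    using () renaming (interchange to +-interchange)
  open CommutativeSemigroupProperties *-commutativeSemigroup public
    using () renaming (interchange to *-interchange)
  open SemiringMult semiring public using (_×_; ×-homo-1; ×-homo-+; ×1-homo-*; ×-assoc-*)
  open CommutativeSemiringExp commutativeSemiring public using () renaming (_^_ to _^ᴿ_)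
  open CommutativeSemiringExp commutativeSemiring using (^-homo-*; ^-assocʳ; ^-distrib-*)

  fromℕ : ℕ → Carrier
  fromℕ n = n × 1#

  private
    fromℤ : ℤ → Carrier
    fromℤ (ℤ.+ n)   = fromℕ n
    fromℤ -[1+ n ]  = - fromℕ (suc n)

    [1+x]-[1+y]≡x-y : ∀ x y → (1# + x) - (1# + y) ≡ x - y
    [1+x]-[1+y]≡x-y x y = begin
      (1# + x) + - (1# + y)      ≡⟨ cong ((1# + x) +_) (sym (-‿+-comm 1# y)) ⟩
      (1# + x) + (- 1# + - y)    ≡⟨ +-interchange 1# x (- 1#) (- y) ⟩
      (1# - 1#) + (x - y)        ≡⟨ cong (_+ (x - y)) (-‿inverseʳ 1#) ⟩
      0# + (x - y)               ≡⟨ +-identityˡ (x - y) ⟩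
      x - y                      ∎
      where open ≡-Reasoning

    fromℤ-⊖ : ∀ m n → fromℤ (m ⊖ n) ≡ fromℕ m - fromℕ n
    fromℤ-⊖ m       zero    = sym (trans (cong (fromℕ m +_) -0#≈0#) (+-identityʳ _))
    fromℤ-⊖ zero    (suc n) = sym (+-identityˡ _)
    fromℤ-⊖ (suc m) (suc n) = begin
      fromℤ (suc m ⊖ suc n)            ≡⟨ cong fromℤ (ℤ.[1+m]⊖[1+n]≡m⊖n m n) ⟩
      fromℤ (m ⊖ n)                    ≡⟨ fromℤ-⊖ m n ⟩
      fromℕ m - fromℕ n                ≡⟨ sym ([1+x]-[1+y]≡x-y (fromℕ m) (fromℕ n)) ⟩
      fromℕ (suc m) - fromℕ (suc n)    ∎
      where open ≡-Reasoning

    fromℤ-+ : ∀ i j → fromℤ (i ℤ.+ j) ≡ fromℤ i + fromℤ j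
    fromℤ-+ (ℤ.+ m)  (ℤ.+ n)  = ×-homo-+ 1# m n
    fromℤ-+ (ℤ.+ m)  -[1+ n ] = fromℤ-⊖ m (suc n)
    fromℤ-+ -[1+ m ] (ℤ.+ n)  = trans (fromℤ-⊖ n (suc m)) (+-comm _ _)
    fromℤ-+ -[1+ m ] -[1+ n ] = begin
      - fromℕ (suc (suc (m ℕ.+ n)))        ≡⟨ cong (λ k → - fromℕ k) (sym (ℕ.+-suc (suc m) n)) ⟩
      - fromℕ (suc m ℕ.+ suc n)            ≡⟨ cong -_ (×-homo-+ 1# (suc m) (suc n)) ⟩
      - (fromℕ (suc m) + fromℕ (suc n))    ≡⟨ sym (-‿+-comm _ _) ⟩
      - fromℕ (suc m) + - fromℕ (suc n)    ∎
      where open ≡-Reasoning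

    signed : Sign → Carrier
    signed Sign.+ = 1#
    signed Sign.- = - 1#

    signed-* : ∀ s t → signed (s Sign.* t) ≡ signed s * signed t
    signed-* Sign.+ t      = sym (*-identityˡ _)
    signed-* Sign.- Sign.+ = sym (*-identityʳ _)
    signed-* Sign.- Sign.- = sym (trans (-1*x≈-x _) (-‿involutive 1#))

    fromℤ-◃ : ∀ s n → fromℤ (s ◃ n) ≡ signed s * fromℕ n
    fromℤ-◃ s      zero    = sym (zeroʳ _)
    fromℤ-◃ Sign.+ (suc n) = sym (*-identityˡ _)
    fromℤ-◃ Sign.- (suc n) = sym (-1*x≈-x _)

    fromℤ≡signed*fromℕ : ∀ i → fromℤ i ≡ signed (ℤ.sign i) * fromℕ ℤ.∣ i ∣
    fromℤ≡signed*fromℕ i = trans (cong fromℤ (sym (ℤ.◃-inverse i))) (fromℤ-◃ (ℤ.sign i) ℤ.∣ i ∣)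

    fromℤ-* : ∀ i j → fromℤ (i ℤ.* j) ≡ fromℤ i * fromℤ j
    fromℤ-* i j = begin
      fromℤ (i ℤ.* j)                                      ≡⟨ fromℤ-◃ (si Sign.* sj) (∣i∣ ℕ.* ∣j∣) ⟩
      signed (si Sign.* sj) * fromℕ (∣i∣ ℕ.* ∣j∣)          ≡⟨ cong₂ _*_ (signed-* si sj) (×1-homo-* ∣i∣ ∣j∣) ⟩
      (signed si * signed sj) * (fromℕ ∣i∣ * fromℕ ∣j∣)    ≡⟨ *-interchange _ _ _ _ ⟩
      (signed si * fromℕ ∣i∣) * (signed sj * fromℕ ∣j∣)    ≡⟨ sym (cong₂ _*_ (fromℤ≡signed*fromℕ i) (fromℤ≡signed*fromℕ j)) ⟩
      fromℤ i * fromℤ j                                    ∎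
      where
      open ≡-Reasoning
      si = ℤ.sign i
      sj = ℤ.sign j
      ∣i∣ = ℤ.∣ i ∣
      ∣j∣ = ℤ.∣ j ∣

    fromℤ-neg : ∀ i → fromℤ (ℤ.- i) ≡ - fromℤ i
    fromℤ-neg (ℤ.+ zero)  = sym -0#≈0#
    fromℤ-neg (ℤ.+ suc n) = refl
    fromℤ-neg -[1+ n ]    = sym (-‿involutive _)

    fromℤ-homomorphism : ℤ.+-*-rawRing -Raw-AlmostCommutative⟶ fromCommutativeRing commutativeRing
    fromℤ-homomorphism = record
      { ⟦_⟧    = fromℤ
      ; +-homo = fromℤ-+
      ; *-homo = fromℤ-*
      ; -‿homo = fromℤ-neg
      ; 0-homo = refl
      ; 1-homo = +-identityʳ 1#
      }

    fromℤ-≟ : (i j : ℤ) → Maybe (fromℤ i ≡ fromℤ j)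
    fromℤ-≟ i j with i ℤ.≟ j
    ... | yes i≡j = just (cong fromℤ i≡j)
    ... | no _    = nothing

  -- A constant con (ℤ.+ n) of the solver denotes fromℕ n; in particular 1# and 2# are not
  -- constants for it, and the integer 4 is written fromℕ 4 in statements.
  module Solver = Algebra.Solver.Ring ℤ.+-*-rawRing (fromCommutativeRing commutativeRing) fromℤ-homomorphism fromℤ-≟

  open Solver public using (solve; _:=_; _:+_; _:*_; _:-_; :-_; con)

  1≢0 : 1# ≢ 0#
  1≢0 1≡0 = 0≢1 (sym 1≡0)

  -1≢0 : - 1# ≢ 0#
  -1≢0 -1≡0 = 1≢0 (trans (sym (-‿involutive 1#)) (trans (cong -_ -1≡0) -0#≈0#))

  fromℕ2≡2# : fromℕ 2 ≡ 2#
  fromℕ2≡2# = cong (1# +_) (+-identityʳ 1#)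

  x+x≡2#*x : ∀ x → x + x ≡ 2# * x
  x+x≡2#*x x = sym (trans (distribʳ x 1# 1#) (cong₂ _+_ (*-identityˡ x) (*-identityˡ x)))

  x-y≡0⇒x≡y : ∀ {x y} → x - y ≡ 0# → x ≡ y
  x-y≡0⇒x≡y = x∙y⁻¹≈ε⇒x≈y _ _

  x≡y⇒x-y≡0 : ∀ {x y} → x ≡ y → x - y ≡ 0#
  x≡y⇒x-y≡0 = x≈y⇒x∙y⁻¹≈ε

  x+y≡0⇒x≡-y : ∀ {x y} → x + y ≡ 0# → x ≡ - y
  x+y≡0⇒x≡-y = +-inverseˡ-unique _ _

  ⁻¹-inverseˡ : ∀ x → x ≢ 0# → x ⁻¹ * x ≡ 1#
  ⁻¹-inverseˡ x x≢0 = trans (*-comm _ _) (⁻¹-inverse x x≢0)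

  *-cancelˡ : ∀ x {y z} → x ≢ 0# → x * y ≡ x * z → y ≡ z
  *-cancelˡ x {y} {z} x≢0 xy≡xz = begin
    y                 ≡⟨ sym (*-identityˡ y) ⟩
    1# * y            ≡⟨ cong (_* y) (sym (⁻¹-inverseˡ x x≢0)) ⟩
    (x ⁻¹ * x) * y    ≡⟨ *-assoc _ _ _ ⟩
    x ⁻¹ * (x * y)    ≡⟨ cong (x ⁻¹ *_) xy≡xz ⟩
    x ⁻¹ * (x * z)    ≡⟨ sym (*-assoc _ _ _) ⟩
    (x ⁻¹ * x) * z    ≡⟨ cong (_* z) (⁻¹-inverseˡ x x≢0) ⟩
    1# * z            ≡⟨ *-identityˡ z ⟩
    z                 ∎
    where open ≡-Reasoning

  x*y≢0 : ∀ {x y} → x ≢ 0# → y ≢ 0# → x * y ≢ 0#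
  x*y≢0 {x} x≢0 y≢0 xy≡0 = y≢0 (*-cancelˡ x x≢0 (trans xy≡0 (sym (zeroʳ x))))

  x*y≡0⇒x≡0 : ∀ {x y} → y ≢ 0# → x * y ≡ 0# → x ≡ 0#
  x*y≡0⇒x≡0 {x} {y} y≢0 xy≡0 = *-cancelˡ y y≢0 (trans (*-comm y x) (trans xy≡0 (sym (zeroʳ y))))

  x*x≡y⇒x≢0 : ∀ {x y} → x * x ≡ y → y ≢ 0# → x ≢ 0#
  x*x≡y⇒x≢0 {x} x*x≡y y≢0 x≡0 = y≢0 (trans (sym x*x≡y) (trans (cong (_* x) x≡0) (zeroˡ x)))

  x⁻¹≢0 : ∀ {x} → x ≢ 0# → x ⁻¹ ≢ 0#
  x⁻¹≢0 {x} x≢0 x⁻¹≡0 = 0≢1 (trans (sym (zeroʳ x)) (trans (cong (x *_) (sym x⁻¹≡0)) (⁻¹-inverse x x≢0)))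

  ⁻¹-unique : ∀ x y → x * y ≡ 1# → y ≡ x ⁻¹
  ⁻¹-unique x y xy≡1 = *-cancelˡ x x≢0 (trans xy≡1 (sym (⁻¹-inverse x x≢0)))
    where
    x≢0 : x ≢ 0#
    x≢0 x≡0 = 1≢0 (trans (sym xy≡1) (trans (cong (_* y) x≡0) (zeroˡ y)))

  ⁻¹-involutive : ∀ {x} → x ≢ 0# → x ⁻¹ ⁻¹ ≡ x
  ⁻¹-involutive {x} x≢0 = sym (⁻¹-unique (x ⁻¹) x (⁻¹-inverseˡ x x≢0))

  [x*y⁻¹]⁻¹≡y*x⁻¹ : ∀ {x y} → x ≢ 0# → y ≢ 0# → (x * y ⁻¹) ⁻¹ ≡ y * x ⁻¹
  [x*y⁻¹]⁻¹≡y*x⁻¹ {x} {y} x≢0 y≢0 = sym (⁻¹-unique (x * y ⁻¹) (y * x ⁻¹) (begin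
    (x * y ⁻¹) * (y * x ⁻¹)    ≡⟨ solve 4 (λ x i y j → (x :* i) :* (y :* j) := (x :* j) :* (y :* i)) refl x (y ⁻¹) y (x ⁻¹) ⟩
    (x * x ⁻¹) * (y * y ⁻¹)    ≡⟨ cong₂ _*_ (⁻¹-inverse x x≢0) (⁻¹-inverse y y≢0) ⟩
    1# * 1#                    ≡⟨ *-identityˡ 1# ⟩
    1#                         ∎))
    where open ≡-Reasoning

  x*[y*x⁻¹]≡y : ∀ {x} y → x ≢ 0# → x * (y * x ⁻¹) ≡ y
  x*[y*x⁻¹]≡y {x} y x≢0 = begin
    x * (y * x ⁻¹)    ≡⟨ solve 3 (λ x y i → x :* (y :* i) := y :* (x :* i)) refl x y (x ⁻¹) ⟩
    y * (x * x ⁻¹)    ≡⟨ cong (y *_) (⁻¹-inverse x x≢0) ⟩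
    y * 1#            ≡⟨ *-identityʳ y ⟩
    y                 ∎
    where open ≡-Reasoning

  ^≡^ᴿ : ∀ x n → x ^ n ≡ x ^ᴿ n
  ^≡^ᴿ x zero    = refl
  ^≡^ᴿ x (suc n) = cong (x *_) (^≡^ᴿ x n)

  ^-+ : ∀ x m n → x ^ (m ℕ.+ n) ≡ x ^ m * x ^ n
  ^-+ x m n = begin
    x ^ (m ℕ.+ n)      ≡⟨ ^≡^ᴿ x (m ℕ.+ n) ⟩
    x ^ᴿ (m ℕ.+ n)     ≡⟨ ^-homo-* x m n ⟩
    x ^ᴿ m * x ^ᴿ n    ≡⟨ sym (cong₂ _*_ (^≡^ᴿ x m) (^≡^ᴿ x n)) ⟩
    x ^ m * x ^ n      ∎
    where open ≡-Reasoning

  ^-* : ∀ x m n → x ^ (m ℕ.* n) ≡ (x ^ m) ^ n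
  ^-* x m n = begin
    x ^ (m ℕ.* n)      ≡⟨ ^≡^ᴿ x (m ℕ.* n) ⟩
    x ^ᴿ (m ℕ.* n)     ≡⟨ sym (^-assocʳ x m n) ⟩
    (x ^ᴿ m) ^ᴿ n      ≡⟨ sym (trans (^≡^ᴿ (x ^ m) n) (cong (_^ᴿ n) (^≡^ᴿ x m))) ⟩
    (x ^ m) ^ n        ∎
    where open ≡-Reasoning

  *-^ : ∀ x y n → (x * y) ^ n ≡ x ^ n * y ^ n
  *-^ x y n = begin
    (x * y) ^ n        ≡⟨ ^≡^ᴿ (x * y) n ⟩
    (x * y) ^ᴿ n       ≡⟨ ^-distrib-* x y n ⟩
    x ^ᴿ n * y ^ᴿ n    ≡⟨ sym (cong₂ _*_ (^≡^ᴿ x n) (^≡^ᴿ y n)) ⟩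
    x ^ n * y ^ n      ∎
    where open ≡-Reasoning

  1^ : ∀ n → 1# ^ n ≡ 1#
  1^ zero    = refl
  1^ (suc n) = trans (*-identityˡ _) (1^ n)

  x^n≢0 : ∀ {x} n → x ≢ 0# → x ^ n ≢ 0#
  x^n≢0 zero    x≢0 = 1≢0
  x^n≢0 (suc n) x≢0 = x*y≢0 x≢0 (x^n≢0 n x≢0)

  fromℕ-^ : ∀ m n → fromℕ (m ℕ.^ n) ≡ fromℕ m ^ n
  fromℕ-^ m zero    = +-identityʳ 1#
  fromℕ-^ m (suc n) = trans (×1-homo-* m (m ℕ.^ n)) (cong (fromℕ m *_) (fromℕ-^ m n))

module DecidableFieldProperties (F : Field) (_≟_ : DecidableEquality (Field.Carrier F)) where

  open import Data.Sum using (_⊎_; inj₁; inj₂)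
  open import Relation.Nullary using (yes; no)
  open FieldProperties F

  x*y≡0⇒x≡0⊎y≡0 : ∀ {x y} → x * y ≡ 0# → x ≡ 0# ⊎ y ≡ 0#
  x*y≡0⇒x≡0⊎y≡0 {x} xy≡0 with x ≟ 0#
  ... | yes x≡0 = inj₁ x≡0
  ... | no  x≢0 = inj₂ (*-cancelˡ x x≢0 (trans xy≡0 (sym (zeroʳ x))))

  x*x≡y*y⇒x≡±y : ∀ {x y} → x * x ≡ y * y → x ≡ y ⊎ x ≡ - y
  x*x≡y*y⇒x≡±y {x} {y} x²≡y² with x*y≡0⇒x≡0⊎y≡0 (begin
      (x - y) * (x + y)   ≡⟨ solve 2 (λ x y → (x :- y) :* (x :+ y) := x :* x :- y :* y) refl x y ⟩
      x * x - y * y       ≡⟨ cong (_- y * y) x²≡y² ⟩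
      y * y - y * y       ≡⟨ -‿inverseʳ (y * y) ⟩
      0#                  ∎)
    where open ≡-Reasoning
  ... | inj₁ x-y≡0 = inj₁ (x-y≡0⇒x≡y x-y≡0)
  ... | inj₂ x+y≡0 = inj₂ (x+y≡0⇒x≡-y x+y≡0)

module Frobenius (F : Field) where

  open import Data.Nat using (s≤s; z≤n)
  open import Data.Nat.Combinatorics using (_C_; nCn≡1)
  open import Data.Nat.Divisibility using (_∣_; divides)
  open import Data.Nat.Primality using (Prime)
  open import Data.Fin as Fin using (Fin; toℕ; inject₁)
  import Data.Fin.Properties as Fin
  import Algebra.Properties.Semiring.Binomial as Binomialᴿ
  open FieldProperties F
  open import Algebra.Properties.Semiring.Sum semiring using (sum; sum-init-last; sum-cong-≗; sum-replicate-zero)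
  open Binomial using (prime∣pCk)

  p∣n⇒n×x≡0 : ∀ {p n} x → fromℕ p ≡ 0# → p ∣ n → n × x ≡ 0#
  p∣n⇒n×x≡0 {p} {n} x char-p (divides j n≡j*p) = begin
    n × x                    ≡⟨ sym (trans (×-assoc-* n 1# x) (cong (n ×_) (*-identityˡ x))) ⟩
    fromℕ n * x              ≡⟨ cong (λ m → fromℕ m * x) n≡j*p ⟩
    fromℕ (j ℕ.* p) * x      ≡⟨ cong (_* x) (×1-homo-* j p) ⟩
    fromℕ j * fromℕ p * x    ≡⟨ cong (λ c → fromℕ j * c * x) char-p ⟩
    fromℕ j * 0# * x         ≡⟨ cong (_* x) (zeroʳ _) ⟩
    0# * x                   ≡⟨ zeroˡ x ⟩
    0#                       ∎
    where open ≡-Reasoning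

  frobenius-+ : ∀ {p} → Prime p → fromℕ p ≡ 0# → ∀ x y → (x + y) ^ p ≡ x ^ p + y ^ p
  frobenius-+ {suc m} p-prime char-p x y = begin
    (x + y) ^ suc m                                ≡⟨ ^≡^ᴿ (x + y) (suc m) ⟩
    (x + y) ^ᴿ suc m                               ≡⟨ theorem (*-comm x y) (suc m) ⟩
    term Fin.zero + sum (λ i → term (Fin.suc i))   ≡⟨ cong₂ _+_ first-term other-terms ⟩
    y ^ suc m + x ^ suc m                          ≡⟨ +-comm _ _ ⟩
    x ^ suc m + y ^ suc m                          ∎
    where
    open ≡-Reasoning
    open Binomialᴿ semiring x y using (theorem; binomialTerm)
    term = binomialTerm (suc m)

    first-term : term Fin.zero ≡ y ^ suc m
    first-term = trans (×-homo-1 _) (trans (*-identityˡ _) (sym (^≡^ᴿ y (suc m))))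

    last-term : term (Fin.suc (Fin.fromℕ m)) ≡ x ^ suc m
    last-term = begin
      (suc m C toℕ (Fin.suc (Fin.fromℕ m))) × (x ^ᴿ toℕ (Fin.suc (Fin.fromℕ m)) * y ^ᴿ (m ℕ.∸ toℕ (Fin.fromℕ m)))
        ≡⟨ cong (λ k → (suc m C suc k) × (x ^ᴿ suc k * y ^ᴿ (m ℕ.∸ k))) (Fin.toℕ-fromℕ m) ⟩
      (suc m C suc m) × (x ^ᴿ suc m * y ^ᴿ (m ℕ.∸ m))
        ≡⟨ cong₂ (λ c k → c × (x ^ᴿ suc m * y ^ᴿ k)) (nCn≡1 (suc m)) (ℕ.n∸n≡0 m) ⟩
      1 × (x ^ᴿ suc m * 1#)   ≡⟨ ×-homo-1 _ ⟩
      x ^ᴿ suc m * 1#         ≡⟨ *-identityʳ _ ⟩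
      x ^ᴿ suc m              ≡⟨ sym (^≡^ᴿ x (suc m)) ⟩
      x ^ suc m               ∎

    middle-term : ∀ (i : Fin m) → term (Fin.suc (inject₁ i)) ≡ 0#
    middle-term i = p∣n⇒n×x≡0 _ char-p (prime∣pCk p-prime (s≤s z≤n) (s≤s (Fin.inject₁ℕ< i)))

    other-terms : sum (λ i → term (Fin.suc i)) ≡ x ^ suc m
    other-terms = begin
      sum (λ i → term (Fin.suc i))
        ≡⟨ sum-init-last (λ i → term (Fin.suc i)) ⟩
      sum (λ i → term (Fin.suc (inject₁ i))) + term (Fin.suc (Fin.fromℕ m))
        ≡⟨ cong₂ _+_ (trans (sum-cong-≗ middle-term) (sum-replicate-zero m)) last-term ⟩
      0# + x ^ suc m
        ≡⟨ +-identityˡ _ ⟩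
      x ^ suc m
        ∎

  frobenius-+-^ : ∀ {p} → Prime p → fromℕ p ≡ 0# → ∀ j x y → (x + y) ^ (p ℕ.^ j) ≡ x ^ (p ℕ.^ j) + y ^ (p ℕ.^ j)
  frobenius-+-^ p-prime char-p zero    x y = trans (*-identityʳ _) (sym (cong₂ _+_ (*-identityʳ x) (*-identityʳ y)))
  frobenius-+-^ {p} p-prime char-p (suc j) x y = begin
    (x + y) ^ (p ℕ.* p ℕ.^ j)                      ≡⟨ ^-* (x + y) p (p ℕ.^ j) ⟩
    ((x + y) ^ p) ^ (p ℕ.^ j)                      ≡⟨ cong (_^ (p ℕ.^ j)) (frobenius-+ p-prime char-p x y) ⟩
    (x ^ p + y ^ p) ^ (p ℕ.^ j)                    ≡⟨ frobenius-+-^ p-prime char-p j _ _ ⟩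
    (x ^ p) ^ (p ℕ.^ j) + (y ^ p) ^ (p ℕ.^ j)      ≡⟨ sym (cong₂ _+_ (^-* x p (p ℕ.^ j)) (^-* y p (p ℕ.^ j))) ⟩
    x ^ (p ℕ.* p ℕ.^ j) + y ^ (p ℕ.* p ℕ.^ j)      ∎
    where open ≡-Reasoning

module FiniteField (F : Field) {N : ℕ} (card : HasCard F N) where

  import Data.Fin as Fin
  open import Data.List using (List; []; _∷_; map; length; allFin)
  import Data.List.Properties as List
  open import Data.List.Membership.Propositional using (_∈_; lose)
  open import Data.List.Membership.Propositional.Properties using (∈-map⁺; ∈-map⁻; ∈-allFin)
  open import Data.List.Relation.Binary.Permutation.Propositional using (_↭_)
  open import Data.List.Relation.Binary.Permutation.Propositional.Properties using (↭-length)
  open import Data.List.Relation.Unary.Any as Any using (here; there; any?)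
  open import Data.List.Relation.Unary.Unique.Propositional using (Unique)
  import Data.List.Relation.Unary.Unique.Propositional.Properties as Unique
  open import Data.Product using (∃; _×_; _,_; proj₁; proj₂)
  open import Data.Sum using (inj₁; inj₂)
  open import Data.Empty using (⊥-elim)
  open import Function.Bundles using (Inverse; mk⇔)
  open import Relation.Nullary using (yes; no)
  open import Relation.Nullary.Decidable using (map′)
  open FieldProperties F

  open Inverse card using (to; from; strictlyInverseˡ; strictlyInverseʳ)

  private
    to-injective : ∀ {x y} → to x ≡ to y → x ≡ y
    to-injective {x} {y} tx≡ty = trans (sym (strictlyInverseʳ x)) (trans (cong from tx≡ty) (strictlyInverseʳ y))

    from-injective : ∀ {i j} → from i ≡ from j → i ≡ j
    from-injective {i} {j} fi≡fj = trans (sym (strictlyInverseˡ i)) (trans (cong to fi≡fj) (strictlyInverseˡ j))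

  infix 4 _≟_
  _≟_ : DecidableEquality Carrier
  x ≟ y = map′ to-injective (cong to) (to x Fin.≟ to y)

  open DecidableFieldProperties F _≟_

  elements : List Carrier
  elements = map from (allFin N)

  ∈-elements : ∀ x → x ∈ elements
  ∈-elements x = subst (_∈ elements) (strictlyInverseʳ x) (∈-map⁺ from (∈-allFin (to x)))

  elements-unique : Unique elements
  elements-unique = Unique.map⁺ from-injective (Unique.allFin⁺ N)

  length-elements : length elements ≡ N
  length-elements = trans (List.length-map from (allFin N)) (List.length-tabulate (λ i → i))

  module Additive       = CommutativeFold _≟_ +-isCommutativeMonoid
  module Multiplicative = CommutativeFold _≟_ *-isCommutativeMonoid

  fromℕ-N≡0 : fromℕ N ≡ 0#
  fromℕ-N≡0 = +-identityˡ-unique (fromℕ N) (Σ elements) (begin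
    fromℕ N + Σ elements                    ≡⟨ cong (λ n → fromℕ n + Σ elements) (sym length-elements) ⟩
    fromℕ (length elements) + Σ elements    ≡⟨ sym (Additive.fold-map 1# elements) ⟩
    Σ (map (1# +_) elements)                ≡⟨ Additive.fold-↭ translates↭elements ⟩
    Σ elements                              ∎)
    where
    open ≡-Reasoning
    Σ = Additive.fold
    translate : ∀ z → 1# + (- 1# + z) ∈ map (1# +_) elements
    translate z = ∈-map⁺ (1# +_) (∈-elements (- 1# + z))
    1+[-1+z]≡z : ∀ z → 1# + (- 1# + z) ≡ z
    1+[-1+z]≡z = solve 2 (λ o z → o :+ (:- o :+ z) := z) refl 1#
    translates↭elements : map (1# +_) elements ↭ elements
    translates↭elements = Additive.unique-sameElements⇒↭
      (Unique.map⁺ (+-cancelˡ 1# _ _) elements-unique) elements-unique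
      (λ {z} → mk⇔ (λ _ → ∈-elements z) (λ _ → subst (_∈ map (1# +_) elements) (1+[-1+z]≡z z) (translate z)))

  open Multiplicative using (IsPairing; fold-pairing) renaming (fold to Π)

  units : List Carrier
  units = elements Multiplicative.without 0#

  ∈-units : ∀ {x} → x ≢ 0# → x ∈ units
  ∈-units {x} x≢0 = Multiplicative.∈-without⁺ (∈-elements x) x≢0

  units-≢0 : ∀ {x} → x ∈ units → x ≢ 0#
  units-≢0 x∈units = proj₂ (Multiplicative.∈-without⁻ {xs = elements} x∈units)

  units-unique : Unique units
  units-unique = Multiplicative.without-unique elements-unique

  1+length-units≡N : suc (length units) ≡ N
  1+length-units≡N = trans (sym (↭-length (Multiplicative.↭-∷-without elements-unique (∈-elements 0#)))) length-elements

  Π-units≢0 : Π units ≢ 0#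
  Π-units≢0 = Π≢0 units units-≢0
    where
    Π≢0 : ∀ xs → (∀ {x} → x ∈ xs → x ≢ 0#) → Π xs ≢ 0#
    Π≢0 []       _      = 1≢0
    Π≢0 (x ∷ xs) xs≢0   = x*y≢0 (xs≢0 (here refl)) (Π≢0 xs (λ x∈xs → xs≢0 (there x∈xs)))

  x^[N-1]≡1 : ∀ {x} → x ≢ 0# → x ^ length units ≡ 1#
  x^[N-1]≡1 {x} x≢0 = *-cancelˡ (Π units) Π-units≢0 (begin
    Π units * x ^ length units            ≡⟨ *-comm _ _ ⟩
    x ^ length units * Π units            ≡⟨ cong (_* Π units) (^≡^ᴿ x (length units)) ⟩
    x ^ᴿ length units * Π units           ≡⟨ sym (Multiplicative.fold-map x units) ⟩
    Π (map (x *_) units)                  ≡⟨ Multiplicative.fold-↭ scaled↭units ⟩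
    Π units                               ≡⟨ sym (*-identityʳ _) ⟩
    Π units * 1#                          ∎)
    where
    open ≡-Reasoning
    scaled↭units : map (x *_) units ↭ units
    scaled↭units = Multiplicative.unique-sameElements⇒↭
      (Unique.map⁺ (*-cancelˡ x x≢0) units-unique) units-unique
      (mk⇔ (λ z∈ → ∈-units (scaled≢0 z∈)) unit-scaled)
      where
      scaled≢0 : ∀ {z} → z ∈ map (x *_) units → z ≢ 0#
      scaled≢0 z∈ with ∈-map⁻ (x *_) z∈
      ... | y , y∈units , refl = x*y≢0 x≢0 (units-≢0 y∈units)
      unit-scaled : ∀ {z} → z ∈ units → z ∈ map (x *_) units
      unit-scaled {z} z∈units = subst (_∈ map (x *_) units) (x*[y*x⁻¹]≡y z x≢0)
        (∈-map⁺ (x *_) (∈-units (x*y≢0 (units-≢0 z∈units) (x⁻¹≢0 x≢0))))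

  x^N≡x : ∀ x → x ^ N ≡ x
  x^N≡x x with x ≟ 0#
  ... | yes refl = subst (λ n → 0# ^ n ≡ 0#) 1+length-units≡N (zeroˡ _)
  ... | no  x≢0  = subst (λ n → x ^ n ≡ x) 1+length-units≡N (trans (cong (x *_) (x^[N-1]≡1 x≢0)) (*-identityʳ x))

  module _ (1≢-1 : 1# ≢ - 1#) where

    private
      units₁ = units Multiplicative.without 1#
      units₂ = units₁ Multiplicative.without (- 1#)

      ∈-units₂⁻ : ∀ {z} → z ∈ units₂ → z ≢ 0# × z ≢ 1# × z ≢ - 1#
      ∈-units₂⁻ z∈ with Multiplicative.∈-without⁻ {xs = units₁} z∈
      ... | z∈units₁ , z≢-1 with Multiplicative.∈-without⁻ {xs = units} z∈units₁
      ... | z∈units , z≢1 = units-≢0 z∈units , z≢1 , z≢-1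

      ∈-units₂⁺ : ∀ {z} → z ≢ 0# → z ≢ 1# → z ≢ - 1# → z ∈ units₂
      ∈-units₂⁺ z≢0 z≢1 z≢-1 = Multiplicative.∈-without⁺ (Multiplicative.∈-without⁺ (∈-units z≢0) z≢1) z≢-1

      involution-pairing : IsPairing _⁻¹ 1# units₂
      involution-pairing = record
        { ι-closed         = λ x∈ → closed (∈-units₂⁻ x∈)
        ; ι-fixedPointFree = λ x∈ → fixedPointFree (∈-units₂⁻ x∈)
        ; ι-involutive     = λ x∈ → ⁻¹-involutive (proj₁ (∈-units₂⁻ x∈))
        ; ∙-ι              = λ x∈ → ⁻¹-inverse _ (proj₁ (∈-units₂⁻ x∈))
        }
        where
        selfInverse : ∀ {u} → u * u ≡ 1# → u ⁻¹ ≡ u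
        selfInverse {u} u*u≡1 = sym (⁻¹-unique u u u*u≡1)
        x⁻¹≡u⇒x≡u : ∀ {x u} → x ≢ 0# → u * u ≡ 1# → x ⁻¹ ≡ u → x ≡ u
        x⁻¹≡u⇒x≡u x≢0 u*u≡1 x⁻¹≡u = trans (sym (⁻¹-involutive x≢0)) (trans (cong _⁻¹ x⁻¹≡u) (selfInverse u*u≡1))
        1*1≡1 : 1# * 1# ≡ 1#
        1*1≡1 = *-identityˡ 1#
        -1*-1≡1 : - 1# * - 1# ≡ 1#
        -1*-1≡1 = trans (solve 1 (λ o → :- o :* :- o := o :* o) refl 1#) 1*1≡1
        closed : ∀ {x} → x ≢ 0# × x ≢ 1# × x ≢ - 1# → x ⁻¹ ∈ units₂
        closed (x≢0 , x≢1 , x≢-1) = ∈-units₂⁺ (x⁻¹≢0 x≢0)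
          (λ x⁻¹≡1 → x≢1 (x⁻¹≡u⇒x≡u x≢0 1*1≡1 x⁻¹≡1)) (λ x⁻¹≡-1 → x≢-1 (x⁻¹≡u⇒x≡u x≢0 -1*-1≡1 x⁻¹≡-1))
        fixedPointFree : ∀ {x} → x ≢ 0# × x ≢ 1# × x ≢ - 1# → x ⁻¹ ≢ x
        fixedPointFree {x} (x≢0 , x≢1 , x≢-1) x⁻¹≡x
          with x*x≡y*y⇒x≡±y (trans (cong (x *_) (sym x⁻¹≡x)) (trans (⁻¹-inverse x x≢0) (sym 1*1≡1)))
        ... | inj₁ x≡1  = x≢1 x≡1
        ... | inj₂ x≡-1 = x≢-1 x≡-1

    wilson : Π units ≡ - 1#
    wilson = begin
      Π units
        ≡⟨ Multiplicative.fold-↭ (Multiplicative.↭-∷-without units-unique (∈-units 1≢0)) ⟩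
      1# * Π units₁
        ≡⟨ *-identityˡ _ ⟩
      Π units₁
        ≡⟨ Multiplicative.fold-↭ (Multiplicative.↭-∷-without (Multiplicative.without-unique units-unique) -1∈units₁) ⟩
      - 1# * Π units₂
        ≡⟨ cong (- 1# *_) (proj₂ (proj₂ paired)) ⟩
      - 1# * 1# ^ᴿ m
        ≡⟨ cong (- 1# *_) (trans (sym (^≡^ᴿ 1# m)) (1^ m)) ⟩
      - 1# * 1#
        ≡⟨ *-identityʳ _ ⟩
      - 1#
        ∎
      where
      open ≡-Reasoning
      -1∈units₁ : - 1# ∈ units₁
      -1∈units₁ = Multiplicative.∈-without⁺ (∈-units -1≢0) (λ -1≡1 → 1≢-1 (sym -1≡1))
      paired = fold-pairing (Multiplicative.without-unique (Multiplicative.without-unique units-unique)) involution-pairing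
      m = proj₁ paired

    euler-criterion : ∀ {D h} → D ≢ 0# → suc (h ℕ.+ h) ≡ N → D ^ h ≡ 1# → ∃ λ s → s * s ≡ D
    euler-criterion {D} {h} D≢0 1+2h≡N D^h≡1 with any? (λ s → s * s ≟ D) elements
    ... | yes root = Any.satisfied root
    ... | no  no-root = ⊥-elim (1≢-1 (begin
      1#            ≡⟨ sym D^h≡1 ⟩
      D ^ h         ≡⟨ cong (D ^_) (sym m≡h) ⟩
      D ^ m         ≡⟨ ^≡^ᴿ D m ⟩
      D ^ᴿ m        ≡⟨ sym (proj₂ (proj₂ paired)) ⟩
      Π units       ≡⟨ wilson ⟩
      - 1#          ∎))
      where
      open ≡-Reasoning
      x*x≢D : ∀ x → x * x ≢ D
      x*x≢D x x*x≡D = no-root (lose (∈-elements x) x*x≡D)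
      quotient-pairing : IsPairing (λ x → D * x ⁻¹) D units
      quotient-pairing = record
        { ι-closed         = λ x∈ → ∈-units (x*y≢0 D≢0 (x⁻¹≢0 (units-≢0 x∈)))
        ; ι-fixedPointFree = λ {x} x∈ D/x≡x → x*x≢D x (trans (cong (x *_) (sym D/x≡x)) (x*[y*x⁻¹]≡y D (units-≢0 x∈)))
        ; ι-involutive     = λ {x} x∈ → trans (cong (D *_) ([x*y⁻¹]⁻¹≡y*x⁻¹ D≢0 (units-≢0 x∈))) (x*[y*x⁻¹]≡y x D≢0)
        ; ∙-ι              = λ x∈ → x*[y*x⁻¹]≡y D (units-≢0 x∈)
        }
      paired = fold-pairing units-unique quotient-pairing
      m = proj₁ paired
      m≡h : m ≡ h
      m≡h = begin
        m               ≡⟨ ℕ.n≡⌊n+n/2⌋ m ⟩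
        ℕ.⌊ m ℕ.+ m /2⌋ ≡⟨ cong ℕ.⌊_/2⌋ m+m≡h+h ⟩
        ℕ.⌊ h ℕ.+ h /2⌋ ≡⟨ sym (ℕ.n≡⌊n+n/2⌋ h) ⟩
        h               ∎
        where
        m+m≡h+h : m ℕ.+ m ≡ h ℕ.+ h
        m+m≡h+h = trans (proj₁ (proj₂ paired)) (ℕ.suc-injective (trans 1+length-units≡N (sym 1+2h≡N)))

module _ (F : Field) where

  open FieldProperties F

  module Conjugation (q : ℕ)
      (_≟_ : DecidableEquality Carrier)
      (^q-+ : ∀ x y → (x + y) ^ q ≡ x ^ q + y ^ q)
      (^q-involutive : ∀ x → (x ^ q) ^ q ≡ x)
      where

    open import Data.Product using (∃; _×_; _,_; proj₁; proj₂)
    import Data.Integer as ℤ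
    open import Data.Sum using (inj₁; inj₂)
    open import Data.Empty using (⊥-elim)
    open import Relation.Nullary using (yes; no)
    open DecidableFieldProperties F _≟_

    conj : Carrier → Carrier
    conj x = x ^ q

    SelfConjugate : Carrier → Set
    SelfConjugate x = conj x ≡ x

    AntiConjugate : Carrier → Set
    AntiConjugate x = conj x ≡ - x

    conj-+ : ∀ x y → conj (x + y) ≡ conj x + conj y
    conj-+ = ^q-+

    conj-* : ∀ x y → conj (x * y) ≡ conj x * conj y
    conj-* x y = *-^ x y q

    conj-involutive : ∀ x → conj (conj x) ≡ x
    conj-involutive = ^q-involutive

    conj-injective : ∀ {x y} → conj x ≡ conj y → x ≡ y
    conj-injective {x} {y} x̄≡ȳ = trans (sym (conj-involutive x)) (trans (cong conj x̄≡ȳ) (conj-involutive y))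

    conj-0 : conj 0# ≡ 0#
    conj-0 = x+x≈x⇒x≈0 (conj 0#) (trans (sym (conj-+ 0# 0#)) (cong conj (+-identityˡ 0#)))

    conj-1 : conj 1# ≡ 1#
    conj-1 = 1^ q

    conj-neg : ∀ x → conj (- x) ≡ - conj x
    conj-neg x = x+y≡0⇒x≡-y (trans (sym (conj-+ (- x) x)) (trans (cong conj (-‿inverseˡ x)) conj-0))

    conj-sub : ∀ x y → conj (x - y) ≡ conj x - conj y
    conj-sub x y = trans (conj-+ x (- y)) (cong (conj x +_) (conj-neg y))

    conj[x*ȳ]≡x̄*y : ∀ x y → conj (x * conj y) ≡ conj x * y
    conj[x*ȳ]≡x̄*y x y = trans (conj-* x (conj y)) (cong (conj x *_) (conj-involutive y))

    conj-≢0 : ∀ {x} → x ≢ 0# → conj x ≢ 0#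
    conj-≢0 x≢0 x̄≡0 = x≢0 (conj-injective (trans x̄≡0 (sym conj-0)))

    conj-⁻¹ : ∀ {x} → x ≢ 0# → conj (x ⁻¹) ≡ conj x ⁻¹
    conj-⁻¹ {x} x≢0 = ⁻¹-unique (conj x) (conj (x ⁻¹)) (trans (sym (conj-* x (x ⁻¹))) (trans (cong conj (⁻¹-inverse x x≢0)) conj-1))

    x^[q+1]≡x*x̄ : ∀ x → x ^ (q ℕ.+ 1) ≡ x * conj x
    x^[q+1]≡x*x̄ x = trans (^-+ x q 1) (trans (cong (conj x *_) (*-identityʳ x)) (*-comm _ _))

    norm-selfConjugate : ∀ x → SelfConjugate (x * conj x)
    norm-selfConjugate x = trans (conj-* x (conj x)) (trans (cong (conj x *_) (conj-involutive x)) (*-comm _ _))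

    norm≢0 : ∀ {x} → x ≢ 0# → x * conj x ≢ 0#
    norm≢0 x≢0 = x*y≢0 x≢0 (conj-≢0 x≢0)

    selfConjugate-+ : ∀ {x y} → SelfConjugate x → SelfConjugate y → SelfConjugate (x + y)
    selfConjugate-+ {x} {y} x̄≡x ȳ≡y = trans (conj-+ x y) (cong₂ _+_ x̄≡x ȳ≡y)

    selfConjugate-sub : ∀ {x y} → SelfConjugate x → SelfConjugate y → SelfConjugate (x - y)
    selfConjugate-sub {x} {y} x̄≡x ȳ≡y = trans (conj-sub x y) (cong₂ _-_ x̄≡x ȳ≡y)

    selfConjugate-* : ∀ {x y} → SelfConjugate x → SelfConjugate y → SelfConjugate (x * y)
    selfConjugate-* {x} {y} x̄≡x ȳ≡y = trans (conj-* x y) (cong₂ _*_ x̄≡x ȳ≡y)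

    antiConjugate-* : ∀ {x y} → SelfConjugate x → AntiConjugate y → AntiConjugate (x * y)
    antiConjugate-* {x} {y} x̄≡x ȳ≡-y = trans (conj-* x y) (trans (cong₂ _*_ x̄≡x ȳ≡-y) (sym (-‿distribʳ-* x y)))

    x-x̄-antiConjugate : ∀ x → AntiConjugate (x - conj x)
    x-x̄-antiConjugate x = begin
      conj (x - conj x)          ≡⟨ conj-sub x (conj x) ⟩
      conj x - conj (conj x)     ≡⟨ cong (λ y → conj x - y) (conj-involutive x) ⟩
      conj x - x                 ≡⟨ solve 2 (λ x y → y :- x := :- (x :- y)) refl x (conj x) ⟩
      - (x - conj x)             ∎
      where open ≡-Reasoning

    square-root-antiConjugate : ∀ {v s} → SelfConjugate v → s * s ≡ v → conj s ≢ s → AntiConjugate s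
    square-root-antiConjugate {v} {s} v̄≡v s*s≡v s̄≢s with x*x≡y*y⇒x≡±y s̄²≡s²
      where
      s̄²≡s² : conj s * conj s ≡ s * s
      s̄²≡s² = trans (sym (conj-* s s)) (trans (cong conj s*s≡v) (trans v̄≡v (sym s*s≡v)))
    ... | inj₁ s̄≡s  = ⊥-elim (s̄≢s s̄≡s)
    ... | inj₂ s̄≡-s = s̄≡-s

    norm≡0⇒≡0 : ∀ {x} → x * conj x ≡ 0# → x ≡ 0#
    norm≡0⇒≡0 {x} xx̄≡0 with x ≟ 0#
    ... | yes x≡0 = x≡0
    ... | no  x≢0 = ⊥-elim (norm≢0 x≢0 xx̄≡0)

    norm-quotient≡1 : ∀ {a b} → b ≢ 0# → a * conj a ≡ b * conj b → (a * b ⁻¹) * conj (a * b ⁻¹) ≡ 1#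
    norm-quotient≡1 {a} {b} b≢0 aā≡bb̄ = begin
      (a * b ⁻¹) * conj (a * b ⁻¹)
        ≡⟨ cong ((a * b ⁻¹) *_) (trans (conj-* a (b ⁻¹)) (cong (conj a *_) (conj-⁻¹ b≢0))) ⟩
      (a * b ⁻¹) * (conj a * conj b ⁻¹)
        ≡⟨ *-interchange a (b ⁻¹) (conj a) (conj b ⁻¹) ⟩
      (a * conj a) * (b ⁻¹ * conj b ⁻¹)
        ≡⟨ cong (_* (b ⁻¹ * conj b ⁻¹)) aā≡bb̄ ⟩
      (b * conj b) * (b ⁻¹ * conj b ⁻¹)
        ≡⟨ *-interchange b (conj b) (b ⁻¹) (conj b ⁻¹) ⟩
      (b * b ⁻¹) * (conj b * conj b ⁻¹)
        ≡⟨ cong₂ _*_ (⁻¹-inverse b b≢0) (⁻¹-inverse (conj b) (conj-≢0 b≢0)) ⟩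
      1# * 1#
        ≡⟨ *-identityˡ 1# ⟩
      1#
        ∎
      where open ≡-Reasoning

    -- x = 1 + c̄ works unless c = -1, and then any nonzero anticonjugate x does.
    hilbert90 : ∀ {s c} → AntiConjugate s → s ≢ 0# → c * conj c ≡ 1# → ∃ λ x → x ≢ 0# × conj x ≡ c * x
    hilbert90 {s} {c} s̄≡-s s≢0 cc̄≡1 with (1# + conj c) ≟ 0#
    ... | no 1+c̄≢0 = 1# + conj c , 1+c̄≢0 , (begin
      conj (1# + conj c)         ≡⟨ conj-+ 1# (conj c) ⟩
      conj 1# + conj (conj c)    ≡⟨ cong₂ _+_ conj-1 (conj-involutive c) ⟩
      1# + c                     ≡⟨ solve 2 (λ o c → o :+ c := c :+ o) refl 1# c ⟩
      c + 1#                     ≡⟨ cong₂ _+_ (sym (*-identityʳ c)) (sym cc̄≡1) ⟩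
      c * 1# + c * conj c        ≡⟨ sym (distribˡ c 1# (conj c)) ⟩
      c * (1# + conj c)          ∎)
      where open ≡-Reasoning
    ... | yes 1+c̄≡0 = s , s≢0 , (begin
      conj s                     ≡⟨ s̄≡-s ⟩
      - s                        ≡⟨ sym (-1*x≈-x s) ⟩
      - 1# * s                   ≡⟨ cong (_* s) (sym c≡-1) ⟩
      c * s                      ∎)
      where
      open ≡-Reasoning
      c≡-1 : c ≡ - 1#
      c≡-1 = conj-injective (trans (x+y≡0⇒x≡-y (trans (+-comm (conj c) 1#) 1+c̄≡0)) (sym (trans (conj-neg 1#) (cong -_ conj-1))))

    semilinear-root⇒norms≡ : ∀ {A B y} → y ≢ 0# → A * y + B * conj y ≡ 0# → A * conj A ≡ B * conj B
    semilinear-root⇒norms≡ {A} {B} {y} y≢0 u≡0 = x-y≡0⇒x≡y (x*y≡0⇒x≡0 (norm≢0 y≢0) (begin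
      (A * conj A - B * conj B) * (y * conj y)
        ≡⟨ identity A (conj A) B (conj B) y (conj y) ⟩
      u * v - u * (conj B * y) - (B * conj y) * v
        ≡⟨ cong₂ (λ u v → u * v - u * (conj B * y) - (B * conj y) * v) u≡0 v≡0 ⟩
      0# * 0# - 0# * (conj B * y) - (B * conj y) * 0#
        ≡⟨ solve 2 (λ a b → con (ℤ.+ 0) :* con (ℤ.+ 0) :- con (ℤ.+ 0) :* a :- b :* con (ℤ.+ 0) := con (ℤ.+ 0)) refl (conj B * y) (B * conj y) ⟩
      0#
        ∎))
      where
      open ≡-Reasoning
      u = A * y + B * conj y
      v = conj A * conj y + conj B * y
      v≡0 : v ≡ 0#
      v≡0 = begin
        conj A * conj y + conj B * y                ≡⟨ cong (λ z → conj A * conj y + conj B * z) (sym (conj-involutive y)) ⟩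
        conj A * conj y + conj B * conj (conj y)    ≡⟨ sym (cong₂ _+_ (conj-* A y) (conj-* B (conj y))) ⟩
        conj (A * y) + conj (B * conj y)            ≡⟨ sym (conj-+ (A * y) (B * conj y)) ⟩
        conj u                                      ≡⟨ cong conj u≡0 ⟩
        conj 0#                                     ≡⟨ conj-0 ⟩
        0#                                          ∎
      identity : ∀ A Ā B B̄ y ȳ → (A * Ā - B * B̄) * (y * ȳ)
        ≡ (A * y + B * ȳ) * (Ā * ȳ + B̄ * y) - (A * y + B * ȳ) * (B̄ * y) - (B * ȳ) * (Ā * ȳ + B̄ * y)
      identity = solve 6 (λ A Ā B B̄ y ȳ → (A :* Ā :- B :* B̄) :* (y :* ȳ)
        := (A :* y :+ B :* ȳ) :* (Ā :* ȳ :+ B̄ :* y) :- (A :* y :+ B :* ȳ) :* (B̄ :* y) :- (B :* ȳ) :* (Ā :* ȳ :+ B̄ :* y)) refl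

    norms≡⇒semilinear-root : ∀ {s A B} → AntiConjugate s → s ≢ 0# → A * conj A ≡ B * conj B →
                             ∃ λ y → y ≢ 0# × A * y + B * conj y ≡ 0#
    norms≡⇒semilinear-root {s} {A} {B} s̄≡-s s≢0 AĀ≡BB̄ with B ≟ 0#
    ... | yes B≡0 = 1# , 1≢0 , (begin
      A * 1# + B * conj 1#       ≡⟨ cong₂ (λ a b → a * 1# + b * conj 1#) A≡0 B≡0 ⟩
      0# * 1# + 0# * conj 1#     ≡⟨ solve 2 (λ a b → con (ℤ.+ 0) :* a :+ con (ℤ.+ 0) :* b := con (ℤ.+ 0)) refl 1# (conj 1#) ⟩
      0#                         ∎)
      where
      open ≡-Reasoning
      A≡0 : A ≡ 0#
      A≡0 = norm≡0⇒≡0 (trans AĀ≡BB̄ (trans (cong (_* conj B) B≡0) (zeroˡ _)))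
    ... | no B≢0 = y , y≢0 , (begin
      A * y + B * conj y
        ≡⟨ cong (λ z → A * y + B * z) ȳ≡cy ⟩
      A * y + B * (- (A * B ⁻¹) * y)
        ≡⟨ solve 4 (λ A B i y → A :* y :+ B :* (:- (A :* i) :* y) := A :* y :- A :* y :* (B :* i)) refl A B (B ⁻¹) y ⟩
      A * y - A * y * (B * B ⁻¹)
        ≡⟨ cong (λ z → A * y - A * y * z) (⁻¹-inverse B B≢0) ⟩
      A * y - A * y * 1#
        ≡⟨ cong (λ z → A * y - z) (*-identityʳ _) ⟩
      A * y - A * y
        ≡⟨ -‿inverseʳ _ ⟩
      0#
        ∎)
      where
      open ≡-Reasoning
      c = - (A * B ⁻¹)
      cc̄≡1 : c * conj c ≡ 1#
      cc̄≡1 = begin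
        - (A * B ⁻¹) * conj (- (A * B ⁻¹))
          ≡⟨ cong (- (A * B ⁻¹) *_) (conj-neg (A * B ⁻¹)) ⟩
        - (A * B ⁻¹) * - conj (A * B ⁻¹)
          ≡⟨ solve 2 (λ u v → :- u :* :- v := u :* v) refl (A * B ⁻¹) (conj (A * B ⁻¹)) ⟩
        (A * B ⁻¹) * conj (A * B ⁻¹)
          ≡⟨ norm-quotient≡1 B≢0 AĀ≡BB̄ ⟩
        1#
          ∎
      root = hilbert90 s̄≡-s s≢0 cc̄≡1
      y = proj₁ root
      y≢0 = proj₁ (proj₂ root)
      ȳ≡cy = proj₂ (proj₂ root)

    quadraticForm : Carrier → Carrier → Carrier → Carrier
    quadraticForm β w x = (x * conj x) * β + x * x * w + conj (x * x * w)

    discriminant : Carrier → Carrier → Carrier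
    discriminant β w = β * β - fromℕ 4 * (w * conj w)

    module _ (2≢0 : 2# ≢ 0#) where

      x≡-x⇒x≡0 : ∀ {x} → x ≡ - x → x ≡ 0#
      x≡-x⇒x≡0 {x} x≡-x = *-cancelˡ 2# 2≢0 (begin
        2# * x           ≡⟨ sym (x+x≡2#*x x) ⟩
        x + x            ≡⟨ cong (x +_) x≡-x ⟩
        x - x            ≡⟨ -‿inverseʳ x ⟩
        0#               ≡⟨ sym (zeroʳ 2#) ⟩
        2# * 0#          ∎)
        where open ≡-Reasoning

      antiConj²≡selfConj²⇒≡0 : ∀ {d m} → AntiConjugate d → SelfConjugate m → d * d ≡ m * m → m ≡ 0#
      antiConj²≡selfConj²⇒≡0 {d} {m} d̄≡-d m̄≡m d²≡m² with x*x≡y*y⇒x≡±y d²≡m²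
      ... | inj₁ refl = x≡-x⇒x≡0 (trans (sym m̄≡m) d̄≡-d)
      ... | inj₂ refl = x≡-x⇒x≡0 (begin
        m            ≡⟨ sym (-‿involutive m) ⟩
        - - m        ≡⟨ sym d̄≡-d ⟩
        conj (- m)   ≡⟨ conj-neg m ⟩
        - conj m     ≡⟨ cong -_ m̄≡m ⟩
        - m          ∎)
        where open ≡-Reasoning

      quadraticForm-nonvanishing : ∀ {β w m x} → SelfConjugate β → SelfConjugate m → m ≢ 0# →
        discriminant β w ≡ m * m → x ≢ 0# → quadraticForm β w x ≢ 0#
      quadraticForm-nonvanishing {β} {w} {m} {x} β̄≡β m̄≡m m≢0 Δ≡m² x≢0 form≡0 =
        x*y≢0 (norm≢0 x≢0) m≢0 (antiConj²≡selfConj²⇒≡0 (x-x̄-antiConjugate z) (selfConjugate-* (norm-selfConjugate x) m̄≡m) (begin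
          (z - conj z) * (z - conj z)
            ≡⟨ solve 2 (λ z z̄ → (z :- z̄) :* (z :- z̄) := (z :+ z̄) :* (z :+ z̄) :- con (ℤ.+ 4) :* (z :* z̄)) refl z (conj z) ⟩
          (z + conj z) * (z + conj z) - fromℕ 4 * (z * conj z)
            ≡⟨ cong₂ (λ a b → a * a - fromℕ 4 * b) z+z̄≡-nβ zz̄≡n²ww̄ ⟩
          - (n * β) * - (n * β) - fromℕ 4 * ((n * n) * (w * conj w))
            ≡⟨ solve 3 (λ n β p → :- (n :* β) :* :- (n :* β) :- con (ℤ.+ 4) :* ((n :* n) :* p) := (n :* n) :* (β :* β :- con (ℤ.+ 4) :* p)) refl n β (w * conj w) ⟩
          (n * n) * discriminant β w
            ≡⟨ cong ((n * n) *_) Δ≡m² ⟩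
          (n * n) * (m * m)
            ≡⟨ solve 2 (λ n m → (n :* n) :* (m :* m) := (n :* m) :* (n :* m)) refl n m ⟩
          (n * m) * (n * m)
            ∎))
        where
        open ≡-Reasoning
        n = x * conj x
        z = x * x * w
        z+z̄≡-nβ : z + conj z ≡ - (n * β)
        z+z̄≡-nβ = x+y≡0⇒x≡-y (trans (+-comm _ _) (trans (sym (+-assoc _ _ _)) form≡0))
        zz̄≡n²ww̄ : z * conj z ≡ (n * n) * (w * conj w)
        zz̄≡n²ww̄ = begin
          z * conj z
            ≡⟨ cong (z *_) (trans (conj-* (x * x) w) (cong (_* conj w) (conj-* x x))) ⟩
          (x * x * w) * (conj x * conj x * conj w)
            ≡⟨ solve 4 (λ x x̄ w w̄ → (x :* x :* w) :* (x̄ :* x̄ :* w̄) := (x :* x̄ :* (x :* x̄)) :* (w :* w̄)) refl x (conj x) w (conj w) ⟩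
          (n * n) * (w * conj w)
            ∎

      conjugate-roots : ∀ {β w s} → SelfConjugate β → AntiConjugate s → discriminant β w ≡ s * s →
        ∃ λ z → z + conj z ≡ - β × z * conj z ≡ w * conj w
      conjugate-roots {β} {w} {s} β̄≡β s̄≡-s Δ≡s² = z , z+z̄≡-β , zz̄≡ww̄
        where
        open ≡-Reasoning
        i = 2# ⁻¹
        i+i≡1 : i + i ≡ 1#
        i+i≡1 = trans (x+x≡2#*x i) (⁻¹-inverse 2# 2≢0)
        z = (s - β) * i
        z̄≡ : conj z ≡ (- s - β) * i
        z̄≡ = begin
          conj ((s - β) * i)
            ≡⟨ conj-* (s - β) i ⟩
          conj (s - β) * conj i
            ≡⟨ cong₂ _*_ (trans (conj-sub s β) (cong₂ _-_ s̄≡-s β̄≡β)) (trans (conj-⁻¹ 2≢0) (cong _⁻¹ conj-2)) ⟩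
          (- s - β) * i
            ∎
          where
          conj-2 : conj 2# ≡ 2#
          conj-2 = trans (conj-+ 1# 1#) (cong₂ _+_ conj-1 conj-1)
        z+z̄≡-β : z + conj z ≡ - β
        z+z̄≡-β = begin
          z + conj z
            ≡⟨ cong (z +_) z̄≡ ⟩
          (s - β) * i + (- s - β) * i
            ≡⟨ solve 3 (λ s β i → (s :- β) :* i :+ (:- s :- β) :* i := :- (β :* (i :+ i))) refl s β i ⟩
          - (β * (i + i))
            ≡⟨ cong (λ u → - (β * u)) i+i≡1 ⟩
          - (β * 1#)
            ≡⟨ cong -_ (*-identityʳ β) ⟩
          - β
            ∎
        zz̄≡ww̄ : z * conj z ≡ w * conj w
        zz̄≡ww̄ = begin
          z * conj z
            ≡⟨ cong (z *_) z̄≡ ⟩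
          (s - β) * i * ((- s - β) * i)
            ≡⟨ solve 3 (λ s β i → (s :- β) :* i :* ((:- s :- β) :* i) := (β :* β :- s :* s) :* (i :* i)) refl s β i ⟩
          (β * β - s * s) * (i * i)
            ≡⟨ cong (λ u → (β * β - u) * (i * i)) (sym Δ≡s²) ⟩
          (β * β - discriminant β w) * (i * i)
            ≡⟨ solve 3 (λ β p i → (β :* β :- (β :* β :- con (ℤ.+ 4) :* p)) :* (i :* i) := p :* ((i :+ i) :* (i :+ i))) refl β (w * conj w) i ⟩
          (w * conj w) * ((i + i) * (i + i))
            ≡⟨ cong (λ u → (w * conj w) * (u * u)) i+i≡1 ⟩
          (w * conj w) * (1# * 1#)
            ≡⟨ trans (cong ((w * conj w) *_) (*-identityˡ 1#)) (*-identityʳ _) ⟩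
          w * conj w
            ∎

      quadraticForm-root : ∀ {β w s} → SelfConjugate β → AntiConjugate s → s ≢ 0# →
        discriminant β w ≡ s * s → ∃ λ x → x ≢ 0# × quadraticForm β w x ≡ 0#
      quadraticForm-root {β} {w} {s} β̄≡β s̄≡-s s≢0 Δ≡s² = x , x≢0 , form≡0
        where
        open ≡-Reasoning
        roots = conjugate-roots β̄≡β s̄≡-s Δ≡s²
        z = proj₁ roots
        z+z̄≡-β = proj₁ (proj₂ roots)
        zz̄≡ww̄ = proj₂ (proj₂ roots)
        w≢0 : w ≢ 0#
        w≢0 w≡0 = x*y≢0 s≢0 s≢0 (trans s²≡β² (trans (cong (λ u → u * u) β≡0) (zeroˡ 0#)))
          where
          s²≡β² : s * s ≡ β * β
          s²≡β² = begin
            s * s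
              ≡⟨ sym Δ≡s² ⟩
            β * β - fromℕ 4 * (w * conj w)
              ≡⟨ cong (λ u → β * β - fromℕ 4 * (u * conj u)) w≡0 ⟩
            β * β - fromℕ 4 * (0# * conj 0#)
              ≡⟨ solve 2 (λ β c → β :* β :- con (ℤ.+ 4) :* (con (ℤ.+ 0) :* c) := β :* β) refl β (conj 0#) ⟩
            β * β
              ∎
          β≡0 : β ≡ 0#
          β≡0 = antiConj²≡selfConj²⇒≡0 s̄≡-s β̄≡β s²≡β²
        z≢0 : z ≢ 0#
        z≢0 z≡0 = norm≢0 w≢0 (trans (sym zz̄≡ww̄) (trans (cong (_* conj z) z≡0) (zeroˡ _)))
        solution = hilbert90 s̄≡-s s≢0 (norm-quotient≡1 z≢0 (sym zz̄≡ww̄))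
        x = proj₁ solution
        x≢0 = proj₁ (proj₂ solution)
        x̄≡cx = proj₂ (proj₂ solution)
        n = x * conj x
        x²w≡nz : x * x * w ≡ n * z
        x²w≡nz = begin
          x * x * w                   ≡⟨ *-assoc x x w ⟩
          x * (x * w)                 ≡⟨ cong (x *_) (sym x̄z≡xw) ⟩
          x * (conj x * z)            ≡⟨ sym (*-assoc x (conj x) z) ⟩
          n * z                       ∎
          where
          x̄z≡xw : conj x * z ≡ x * w
          x̄z≡xw = begin
            conj x * z                ≡⟨ cong (_* z) x̄≡cx ⟩
            w * z ⁻¹ * x * z          ≡⟨ solve 4 (λ w i x z → w :* i :* x :* z := x :* (w :* (z :* i))) refl w (z ⁻¹) x z ⟩
            x * (w * (z * z ⁻¹))      ≡⟨ cong (λ u → x * (w * u)) (⁻¹-inverse z z≢0) ⟩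
            x * (w * 1#)              ≡⟨ cong (x *_) (*-identityʳ w) ⟩
            x * w                     ∎
        form≡0 : quadraticForm β w x ≡ 0#
        form≡0 = begin
          n * β + x * x * w + conj (x * x * w)
            ≡⟨ cong₂ (λ u v → n * β + u + conj v) x²w≡nz x²w≡nz ⟩
          n * β + n * z + conj (n * z)
            ≡⟨ cong (n * β + n * z +_) (trans (conj-* n z) (cong (_* conj z) (norm-selfConjugate x))) ⟩
          n * β + n * z + n * conj z
            ≡⟨ solve 4 (λ n β z z̄ → n :* β :+ n :* z :+ n :* z̄ := n :* (β :+ (z :+ z̄))) refl n β z (conj z) ⟩
          n * (β + (z + conj z))
            ≡⟨ cong (λ u → n * (β + u)) z+z̄≡-β ⟩
          n * (β - β)
            ≡⟨ cong (n *_) (-‿inverseʳ β) ⟩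
          n * 0#
            ≡⟨ zeroʳ n ⟩
          0#
            ∎

  module PG3Points (q : ℕ)
      (_≟_ : DecidableEquality Carrier)
      (^q-+ : ∀ x y → (x + y) ^ q ≡ x ^ q + y ^ q)
      (^q-involutive : ∀ x → (x ^ q) ^ q ≡ x)
      (2≢0 : 2# ≢ 0#)
      {t : ℕ} (q≡1+2t : q ≡ suc (t ℕ.+ t))
      where

    open import Data.Nat.DivMod using (_/_; m*n/n≡m)
    open import Data.Product using (∃; _,_; proj₁; proj₂)
    import Data.Integer as ℤ
    open Conjugation q _≟_ ^q-+ ^q-involutive
    open Hermitian q F

    β : Coords → Carrier
    β ⟨ a , b , c , d ⟩ = a * conj a - b * conj b + c * conj c - d * conj d

    ω : Coords → Carrier
    ω ⟨ a , b , c , d ⟩ = a * conj c - b * conj d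

    ω̄ : Coords → Carrier
    ω̄ ⟨ a , b , c , d ⟩ = conj a * c - conj b * d

    conj-ω : ∀ P → conj (ω P) ≡ ω̄ P
    conj-ω ⟨ a , b , c , d ⟩ = trans (conj-sub (a * conj c) (b * conj d)) (cong₂ _-_ (conj[x*ȳ]≡x̄*y a c) (conj[x*ȳ]≡x̄*y b d))

    Aₓ : Coords → Carrier → Carrier
    Aₓ ⟨ a , b , c , d ⟩ x = a * x + c * conj x

    Bₓ : Coords → Carrier → Carrier
    Bₓ ⟨ a , b , c , d ⟩ x = b * x + d * conj x

    T≡ : ∀ P x y → T P x y ≡ Aₓ P x * y + Bₓ P x * conj y
    T≡ ⟨ a , b , c , d ⟩ x y = solve 8
      (λ a b c d x x̄ y ȳ → a :* x :* y :+ b :* x :* ȳ :+ c :* x̄ :* y :+ d :* x̄ :* ȳ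
                          := (a :* x :+ c :* x̄) :* y :+ (b :* x :+ d :* x̄) :* ȳ)
      refl a b c d x (conj x) y (conj y)

    norm-Aₓ-norm-Bₓ : ∀ P x → Aₓ P x * conj (Aₓ P x) - Bₓ P x * conj (Bₓ P x) ≡ quadraticForm (β P) (ω P) x
    norm-Aₓ-norm-Bₓ P@(⟨ a , b , c , d ⟩) x = begin
      Aₓ P x * conj (Aₓ P x) - Bₓ P x * conj (Bₓ P x)
        ≡⟨ cong₂ (λ u v → Aₓ P x * u - Bₓ P x * v) (conj-semilinear a c) (conj-semilinear b d) ⟩
      (a * x + c * x̄) * (ā * x̄ + c̄ * x) - (b * x + d * x̄) * (b̄ * x̄ + d̄ * x)
        ≡⟨ solve 10 (λ a ā b b̄ c c̄ d d̄ x x̄ →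
             (a :* x :+ c :* x̄) :* (ā :* x̄ :+ c̄ :* x) :- (b :* x :+ d :* x̄) :* (b̄ :* x̄ :+ d̄ :* x)
             := (x :* x̄) :* (a :* ā :- b :* b̄ :+ c :* c̄ :- d :* d̄) :+ x :* x :* (a :* c̄ :- b :* d̄)
                :+ x̄ :* x̄ :* (ā :* c :- b̄ :* d))
           refl a ā b b̄ c c̄ d d̄ x x̄ ⟩
      (x * x̄) * β P + x * x * ω P + x̄ * x̄ * ω̄ P
        ≡⟨ cong ((x * x̄) * β P + x * x * ω P +_) (sym conj[x²ω]) ⟩
      quadraticForm (β P) (ω P) x
        ∎
      where
      open ≡-Reasoning
      x̄ = conj x
      ā = conj a
      b̄ = conj b
      c̄ = conj c
      d̄ = conj d
      conj-semilinear : ∀ u v → conj (u * x + v * x̄) ≡ conj u * x̄ + conj v * x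
      conj-semilinear u v = trans (conj-+ (u * x) (v * x̄)) (cong₂ _+_ (conj-* u x) (conj[x*ȳ]≡x̄*y v x))
      conj[x²ω] : conj (x * x * ω P) ≡ x̄ * x̄ * ω̄ P
      conj[x²ω] = trans (conj-* (x * x) (ω P)) (cong₂ _*_ (conj-* x x) (conj-ω P))

    Hf′ : Coords → Carrier
    Hf′ ⟨ a , b , c , d ⟩ = a * conj a - b * conj b - c * conj c + d * conj d

    Hf≡Hf′ : ∀ P → Hf P ≡ Hf′ P
    Hf≡Hf′ ⟨ a , b , c , d ⟩ = cong₂ _+_ (cong₂ _-_ (cong₂ _-_ (x^[q+1]≡x*x̄ a) (x^[q+1]≡x*x̄ b)) (x^[q+1]≡x*x̄ c)) (x^[q+1]≡x*x̄ d)

    Hf-selfConjugate : ∀ P → SelfConjugate (Hf P)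
    Hf-selfConjugate P@(⟨ a , b , c , d ⟩) = subst SelfConjugate (sym (Hf≡Hf′ P))
      (selfConjugate-+ (selfConjugate-sub (selfConjugate-sub (norm-selfConjugate a) (norm-selfConjugate b)) (norm-selfConjugate c)) (norm-selfConjugate d))

    β-selfConjugate : ∀ P → SelfConjugate (β P)
    β-selfConjugate ⟨ a , b , c , d ⟩ =
      selfConjugate-sub (selfConjugate-+ (selfConjugate-sub (norm-selfConjugate a) (norm-selfConjugate b)) (norm-selfConjugate c)) (norm-selfConjugate d)

    discriminant≡ : ∀ P → discriminant (β P) (ω P) ≡ Hf P * Hf P - fromℕ 4 * (Qf P * conj (Qf P))
    discriminant≡ P@(⟨ a , b , c , d ⟩) = begin
      discriminant (β P) (ω P)
        ≡⟨ cong (λ u → β P * β P - fromℕ 4 * (ω P * u)) (conj-ω P) ⟩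
      β P * β P - fromℕ 4 * (ω P * ω̄ P)
        ≡⟨ solve 8 (λ a ā b b̄ c c̄ d d̄ →
             (a :* ā :- b :* b̄ :+ c :* c̄ :- d :* d̄) :* (a :* ā :- b :* b̄ :+ c :* c̄ :- d :* d̄)
               :- con (ℤ.+ 4) :* ((a :* c̄ :- b :* d̄) :* (ā :* c :- b̄ :* d))
             := (a :* ā :- b :* b̄ :- c :* c̄ :+ d :* d̄) :* (a :* ā :- b :* b̄ :- c :* c̄ :+ d :* d̄)
               :- con (ℤ.+ 4) :* ((a :* d :- b :* c) :* (ā :* d̄ :- b̄ :* c̄)))
           refl a ā b b̄ c c̄ d d̄ ⟩
      Hf′ P * Hf′ P - fromℕ 4 * (Qf P * (ā * d̄ - b̄ * c̄))
        ≡⟨ cong₂ (λ h u → h * h - fromℕ 4 * (Qf P * u)) (sym (Hf≡Hf′ P)) (sym (trans (conj-sub (a * d) (b * c)) (cong₂ _-_ (conj-* a d) (conj-* b c)))) ⟩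
      Hf P * Hf P - fromℕ 4 * (Qf P * conj (Qf P))
        ∎
      where
      open ≡-Reasoning
      ā = conj a
      b̄ = conj b
      c̄ = conj c
      d̄ = conj d

    private
      e = (q ℕ.+ 1) / 2

      1+t+1+t≡q+1 : suc t ℕ.+ suc t ≡ q ℕ.+ 1
      1+t+1+t≡q+1 = trans (cong suc (ℕ.+-suc t t)) (trans (ℕ.+-comm 1 (suc (t ℕ.+ t))) (cong (ℕ._+ 1) (sym q≡1+2t)))

      e+e≡q+1 : e ℕ.+ e ≡ q ℕ.+ 1
      e+e≡q+1 = trans (cong (λ n → n ℕ.+ n) e≡1+t) 1+t+1+t≡q+1
        where
        open ≡-Reasoning
        e≡1+t : e ≡ suc t
        e≡1+t = begin
          (q ℕ.+ 1) / 2            ≡⟨ cong (_/ 2) (sym 1+t+1+t≡q+1) ⟩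
          (suc t ℕ.+ suc t) / 2    ≡⟨ cong (λ n → (suc t ℕ.+ n) / 2) (sym (ℕ.+-identityʳ (suc t))) ⟩
          (2 ℕ.* suc t) / 2        ≡⟨ cong (_/ 2) (ℕ.*-comm 2 (suc t)) ⟩
          (suc t ℕ.* 2) / 2        ≡⟨ m*n/n≡m (suc t) 2 ⟩
          suc t                    ∎

      x^e*x^e≡x*x̄ : ∀ x → x ^ e * x ^ e ≡ x * conj x
      x^e*x^e≡x*x̄ x = trans (sym (^-+ x e e)) (trans (cong (x ^_) e+e≡q+1) (x^[q+1]≡x*x̄ x))

    InS̃⇒ξ≢0 : ∀ {ξ P} → InS̃ ξ P → ξ ≢ 0#
    InS̃⇒ξ≢0 {ξ} {P} (P∈S , Hf≢0) ξ≡0 = Hf≢0 (begin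
      Hf P                          ≡⟨ x-y≡0⇒x≡y P∈S ⟩
      2# * ξ * Qf P ^ e             ≡⟨ cong (λ u → 2# * u * Qf P ^ e) ξ≡0 ⟩
      2# * 0# * Qf P ^ e            ≡⟨ trans (cong (_* Qf P ^ e) (zeroʳ 2#)) (zeroˡ _) ⟩
      0#                            ∎)
      where open ≡-Reasoning

    discriminant-on-S : ∀ {ξ P} → ξ ≢ 0# → InS ξ P → discriminant (β P) (ω P) ≡ (Hf P * Hf P) * (1# - (ξ ⁻¹) ^ 2)
    discriminant-on-S {ξ} {P} ξ≢0 P∈S = begin
      discriminant (β P) (ω P)
        ≡⟨ discriminant≡ P ⟩
      H * H - fromℕ 4 * (Q * conj Q)
        ≡⟨ cong (λ u → H * H - fromℕ 4 * u) (sym (x^e*x^e≡x*x̄ Q)) ⟩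
      H * H - fromℕ 4 * (R * R)
        ≡⟨ solve 2 (λ H R → H :* H :- con (ℤ.+ 4) :* (R :* R) := H :* H :- (con (ℤ.+ 2) :* R) :* (con (ℤ.+ 2) :* R)) refl H R ⟩
      H * H - (fromℕ 2 * R) * (fromℕ 2 * R)
        ≡⟨ cong (λ u → H * H - u * u) 2R≡H/ξ ⟩
      H * H - (H * ξ ⁻¹) * (H * ξ ⁻¹)
        ≡⟨ sym (cong₂ _-_ (*-identityʳ _) (*-identityʳ _)) ⟩
      H * H * 1# - (H * ξ ⁻¹) * (H * ξ ⁻¹) * 1#
        ≡⟨ solve 3 (λ H i o → H :* H :* o :- (H :* i) :* (H :* i) :* o := (H :* H) :* (o :- i :* (i :* o))) refl H (ξ ⁻¹) 1# ⟩
      (H * H) * (1# - (ξ ⁻¹) ^ 2)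
        ∎
      where
      open ≡-Reasoning
      H = Hf P
      Q = Qf P
      R = Q ^ e
      2R≡H/ξ : fromℕ 2 * R ≡ H * ξ ⁻¹
      2R≡H/ξ = sym (begin
        H * ξ ⁻¹                  ≡⟨ cong (_* ξ ⁻¹) (x-y≡0⇒x≡y P∈S) ⟩
        2# * ξ * R * ξ ⁻¹         ≡⟨ solve 4 (λ t ξ R i → t :* ξ :* R :* i := t :* R :* (ξ :* i)) refl 2# ξ R (ξ ⁻¹) ⟩
        2# * R * (ξ * ξ ⁻¹)       ≡⟨ cong (2# * R *_) (⁻¹-inverse ξ ξ≢0) ⟩
        2# * R * 1#               ≡⟨ *-identityʳ _ ⟩
        2# * R                    ≡⟨ cong (_* R) (sym fromℕ2≡2#) ⟩
        fromℕ 2 * R               ∎)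

    nonsingular-if-discriminant-selfConjugate-square : ∀ {P m} → SelfConjugate m → m ≢ 0# →
      discriminant (β P) (ω P) ≡ m * m → Nonsingular P
    nonsingular-if-discriminant-selfConjugate-square {P} m̄≡m m≢0 Δ≡m² x y x≢0 y≢0 T≡0 =
      quadraticForm-nonvanishing 2≢0 (β-selfConjugate P) m̄≡m m≢0 Δ≡m² x≢0
        (trans (sym (norm-Aₓ-norm-Bₓ P x)) (x≡y⇒x-y≡0 (semilinear-root⇒norms≡ y≢0 (trans (sym (T≡ P x y)) T≡0))))

    singular-if-discriminant-antiConjugate-square : ∀ {P s} → AntiConjugate s → s ≢ 0# →
      discriminant (β P) (ω P) ≡ s * s → Singular P
    singular-if-discriminant-antiConjugate-square {P} s̄≡-s s≢0 Δ≡s² =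
      x , y , x≢0 , y≢0 , trans (T≡ P x y) Ay+Bȳ≡0
      where
      root = quadraticForm-root 2≢0 (β-selfConjugate P) s̄≡-s s≢0 Δ≡s²
      x = proj₁ root
      x≢0 = proj₁ (proj₂ root)
      norms≡ : Aₓ P x * conj (Aₓ P x) ≡ Bₓ P x * conj (Bₓ P x)
      norms≡ = x-y≡0⇒x≡y (trans (norm-Aₓ-norm-Bₓ P x) (proj₂ (proj₂ root)))
      semilinear = norms≡⇒semilinear-root s̄≡-s s≢0 norms≡
      y = proj₁ semilinear
      y≢0 = proj₁ (proj₂ semilinear)
      Ay+Bȳ≡0 = proj₂ (proj₂ semilinear)

    Z₁⇒nonsingular : ∀ {ξ P} → NonzeroSquareFq (1# - (ξ ⁻¹) ^ 2) → InS̃ ξ P → Nonsingular P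
    Z₁⇒nonsingular {ξ} {P} (_ , v≢0 , r , r̄≡r , r²≡v) P∈S̃@(P∈S , Hf≢0) =
      nonsingular-if-discriminant-selfConjugate-square (selfConjugate-* (Hf-selfConjugate P) r̄≡r) (x*y≢0 Hf≢0 (x*x≡y⇒x≢0 r²≡v v≢0)) (begin
        discriminant (β P) (ω P)        ≡⟨ discriminant-on-S (InS̃⇒ξ≢0 P∈S̃) P∈S ⟩
        (Hf P * Hf P) * (1# - (ξ ⁻¹) ^ 2) ≡⟨ cong (Hf P * Hf P *_) (sym r²≡v) ⟩
        (Hf P * Hf P) * (r * r)         ≡⟨ *-interchange (Hf P) (Hf P) r r ⟩
        (Hf P * r) * (Hf P * r)         ∎)
      where open ≡-Reasoning

    Z₂⇒singular : (∀ {v} → SelfConjugate v → v ≢ 0# → ∃ λ s → s * s ≡ v) →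
      ∀ {ξ P} → NonsquareFq (1# - (ξ ⁻¹) ^ 2) → InS̃ ξ P → Singular P
    Z₂⇒singular sqrt {ξ} {P} (v̄≡v , v≢0 , v-nonsquare) P∈S̃@(P∈S , Hf≢0) =
      singular-if-discriminant-antiConjugate-square (antiConjugate-* (Hf-selfConjugate P) s̄≡-s) (x*y≢0 Hf≢0 (x*x≡y⇒x≢0 s²≡v v≢0)) (begin
        discriminant (β P) (ω P)        ≡⟨ discriminant-on-S (InS̃⇒ξ≢0 P∈S̃) P∈S ⟩
        (Hf P * Hf P) * (1# - (ξ ⁻¹) ^ 2) ≡⟨ cong (Hf P * Hf P *_) (sym s²≡v) ⟩
        (Hf P * Hf P) * (s * s)         ≡⟨ *-interchange (Hf P) (Hf P) s s ⟩
        (Hf P * s) * (Hf P * s)         ∎)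
      where
      open ≡-Reasoning
      s = proj₁ (sqrt v̄≡v v≢0)
      s²≡v = proj₂ (sqrt v̄≡v v≢0)
      s̄≡-s : AntiConjugate s
      s̄≡-s = square-root-antiConjugate v̄≡v s²≡v (λ s̄≡s → v-nonsquare (s , s̄≡s , s²≡v))

module FieldOfOrderq² {q : ℕ} (q-oddPrimePower : OddPrimePower q) (F : Field) (card : HasCard F (q ℕ.* q)) where

  open import Data.Nat.DivMod using (_/_; _%_)
  open import Data.Nat.Primality using (Prime)
  open import Data.Product using (∃; _,_; proj₁; proj₂)
  open import Data.Empty using (⊥-elim)
  open import Relation.Nullary using (yes; no)
  open OddNumbers
  open FieldProperties F
  open FiniteField F card using (_≟_; fromℕ-N≡0; x^N≡x; euler-criterion)

  p k t : ℕ
  p = proj₁ q-oddPrimePower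
  k = proj₁ (proj₂ q-oddPrimePower)
  t = q / 2

  p-prime : Prime p
  p-prime = proj₁ (proj₂ (proj₂ q-oddPrimePower))

  p%2≡1 : p % 2 ≡ 1
  p%2≡1 = proj₁ (proj₂ (proj₂ (proj₂ q-oddPrimePower)))

  q≡p^[1+k] : q ≡ p ℕ.^ suc k
  q≡p^[1+k] = proj₂ (proj₂ (proj₂ (proj₂ q-oddPrimePower)))

  q≡1+2t : q ≡ suc (t ℕ.+ t)
  q≡1+2t = n%2≡1⇒n≡1+2[n/2] q (subst (λ n → n % 2 ≡ 1) (sym q≡p^[1+k]) (p%2≡1⇒p^n%2≡1 {p} p%2≡1 (suc k)))

  char-p : fromℕ p ≡ 0#
  char-p with fromℕ p ≟ 0#
  ... | yes p≡0 = p≡0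
  ... | no  p≢0 = ⊥-elim (x*y≢0 q≢0 q≢0 (trans (sym (×1-homo-* q q)) fromℕ-N≡0))
    where
    q≢0 : fromℕ q ≢ 0#
    q≢0 q≡0 = x^n≢0 (suc k) p≢0 (trans (sym (fromℕ-^ p (suc k))) (trans (cong fromℕ (sym q≡p^[1+k])) q≡0))

  2≢0 : 2# ≢ 0#
  2≢0 2≡0 = 1≢0 (begin
    1#                              ≡⟨ sym (+-identityʳ 1#) ⟩
    1# + 0#                         ≡⟨ cong (1# +_) (sym 2u≡0) ⟩
    fromℕ (suc (u ℕ.+ u))           ≡⟨ cong fromℕ (sym (n%2≡1⇒n≡1+2[n/2] p p%2≡1)) ⟩
    fromℕ p                         ≡⟨ char-p ⟩
    0#                              ∎)
    where
    open ≡-Reasoning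
    u = p / 2
    2u≡0 : fromℕ (u ℕ.+ u) ≡ 0#
    2u≡0 = begin
      fromℕ (u ℕ.+ u)               ≡⟨ ×-homo-+ 1# u u ⟩
      fromℕ u + fromℕ u             ≡⟨ x+x≡2#*x (fromℕ u) ⟩
      2# * fromℕ u                  ≡⟨ cong (_* fromℕ u) 2≡0 ⟩
      0# * fromℕ u                  ≡⟨ zeroˡ _ ⟩
      0#                            ∎

  ^q-+ : ∀ x y → (x + y) ^ q ≡ x ^ q + y ^ q
  ^q-+ = subst (λ n → ∀ x y → (x + y) ^ n ≡ x ^ n + y ^ n) (sym q≡p^[1+k]) (Frobenius.frobenius-+-^ F p-prime char-p (suc k))

  ^q-involutive : ∀ x → (x ^ q) ^ q ≡ x
  ^q-involutive x = trans (sym (^-* x q q)) (x^N≡x x)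

  fixedElements-are-squares : ∀ {v} → v ^ q ≡ v → v ≢ 0# → ∃ λ s → s * s ≡ v
  fixedElements-are-squares {v} v^q≡v v≢0 = euler-criterion 1≢-1 {h = h} v≢0 1+2h≡q² v^h≡1
    where
    h = (t ℕ.+ t) ℕ.* suc t
    1≢-1 : 1# ≢ - 1#
    1≢-1 1≡-1 = 2≢0 (trans (cong (1# +_) 1≡-1) (-‿inverseʳ 1#))
    1+2h≡q² : suc (h ℕ.+ h) ≡ q ℕ.* q
    1+2h≡q² = trans (sym ([1+2t]²≡1+2[2t[1+t]] t)) (sym (cong₂ ℕ._*_ q≡1+2t q≡1+2t))
    v^2t≡1 : v ^ (t ℕ.+ t) ≡ 1#
    v^2t≡1 = *-cancelˡ v v≢0 (trans (subst (λ n → v ^ n ≡ v) q≡1+2t v^q≡v) (sym (*-identityʳ v)))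
    v^h≡1 : v ^ h ≡ 1#
    v^h≡1 = trans (^-* v (t ℕ.+ t) (suc t)) (trans (cong (_^ suc t) v^2t≡1) (1^ (suc t)))

  open PG3Points F q _≟_ ^q-+ ^q-involutive 2≢0 {t} q≡1+2t public
    using (Z₁⇒nonsingular; Z₂⇒singular)

open import Data.Nat using (_*_)
open import Data.Product using (_×_; _,_; proj₂)

mainTheorem10 : (q : ℕ) → OddPrimePower q → (F : Field) → HasCard F (q * q) →
    let open Field F
        open Hermitian q F
    in ((ξ : Carrier) → Z₁ ξ → (P : Coords) → NonzeroVec P → InS̃ ξ P → Nonsingular P)
     × ((ξ : Carrier) → Z₂ ξ → (P : Coords) → NonzeroVec P → InS̃ ξ P → Singular P)
mainTheorem10 q q-oddPrimePower F card =
  (λ ξ ξ∈Z₁ P _ P∈S̃ → Z₁⇒nonsingular (proj₂ (proj₂ (proj₂ ξ∈Z₁))) P∈S̃) ,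
  (λ ξ ξ∈Z₂ P _ P∈S̃ → Z₂⇒singular fixedElements-are-squares (proj₂ ξ∈Z₂) P∈S̃)
  where open FieldOfOrderq² q-oddPrimePower F card
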